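{- Let $C_n$ be a signed cycle with vertices $v_1,\dots,v_n$ in cyclic order, and let $T_{m_1},T_{m_2}$ be vertex-disjoint signed trees. Let $U=U(C_n,T_{m_1},T_{m_2},l)$ be obtained by joining the root of $T_{m_1}$ by an edge to $v_1$ and the root of $T_{m_2}$ by an edge to $v_{l+1}$, where $v_1,v_{l+1}$ are at distance $l\ge1$ on the cycle. Then $$\mathrm{per}\, U=\mathrm{per}\big(U(C_n,T_{m_2})\big)\mathrm{per}(T_{m_1})+\mathrm{per}(\{T_{m_1},v_1\})\mathrm{per}(\{T_{m_2},v_{l+1}\})\mathrm{per}(P_{l-1})\mathrm{per}(P_{n-l-1})+\mathrm{per}(\{T_{m_1},v_1\})\mathrm{per}(T_{m_2})\mathrm{per}(P_{n-1}).$$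
   Context: A signed graph has edge weights in $\{1,-1\}$; its permanent is that of its adjacency matrix; the permanent of the empty graph is $1$. $U(C_n,T_{m_2})$ is $U$ with $T_{m_1}$ deleted. $\{T,w\}$ denotes the subgraph induced by the vertices of tree $T$ and the vertex $w$. $P_{n-1}$ is the signed path $C_n\setminus v_1$; $P_{l-1},P_{n-l-1}$ are the two signed paths forming $C_n\setminus\{v_1,v_{l+1}\}$. -}

module Defs where

open import Data.Nat as ℕ using (ℕ; zero; suc; _≤_; _<_; _≤?_; _<?_)
open import Data.Integer as ℤ using (ℤ; +_; -_)
open import Data.Fin using (Fin; toℕ; fromℕ<) renaming (zero to fzero)
open import Data.Fin.Properties using () renaming (_≟_ to _≟ᶠ_)
open import Data.List using (List; []; _∷_; _++_; map; filter; length; concatMap; allFin; foldr)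
open import Data.Vec as Vec using (Vec; lookup; toList)
open import Data.Product using (Σ; _×_; _,_)
open import Data.Sum using (_⊎_; inj₁; inj₂)
open import Data.Unit using (⊤)
open import Relation.Nullary using (¬_; yes; no)
open import Relation.Nullary.Decidable using (_×-dec_)
open import Relation.Binary.PropositionalEquality using (_≡_; _≢_)
open import Data.List.Relation.Unary.Unique.Propositional using (Unique)
import Data.List.Relation.Unary.Unique.DecPropositional as UD

-- Permanent of a square ℤ-matrix: sum over all permutations σ of
-- Fin k of  ∏ᵢ M i (σ i).  Permutations are enumerated as the
-- vectors (σ 0, …, σ (k-1)) with pairwise distinct entries.

allVecs : (k m : ℕ) → List (Vec (Fin m) k)
allVecs zero    m = Vec.[] ∷ []
allVecs (suc k) m = concatMap (λ x → map (x Vec.∷_) (allVecs k m)) (allFin m)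

perms : (k : ℕ) → List (Vec (Fin k) k)
perms k = filter (λ v → UD.unique? _≟ᶠ_ (toList v)) (allVecs k k)

prodFin : (k : ℕ) → (Fin k → ℤ) → ℤ
prodFin zero    f = + 1
prodFin (suc k) f = f fzero ℤ.* prodFin k (λ i → f (Data.Fin.suc i))

sumℤ : List ℤ → ℤ
sumℤ = foldr ℤ._+_ (+ 0)

per : {k : ℕ} → (Fin k → Fin k → ℤ) → ℤ
per {k} M = sumℤ (map (λ σ → prodFin k (λ i → M i (lookup σ i))) (perms k))

-- permanent of the subgraph of a (signed) graph with weights w induced
-- by a list of distinct vertices (the permanent of the empty graph is 1)
perInd : {V : Set} → (V → V → ℤ) → List V → ℤ
perInd w vs = per (λ i j → w (Data.List.lookup vs i) (Data.List.lookup vs j))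

IsSign : ℤ → Set
IsSign e = e ≡ + 1 ⊎ e ≡ - (+ 1)

IsSignedGraph : {m : ℕ} → (Fin m → Fin m → ℤ) → Set
IsSignedGraph {m} w =
  (∀ i j → w i j ≡ w j i) × (∀ i → w i i ≡ + 0) × (∀ i j → w i j ≡ + 0 ⊎ IsSign (w i j))

Adj : {m : ℕ} → (Fin m → Fin m → ℤ) → Fin m → Fin m → Set
Adj w i j = w i j ≢ + 0

Chain : {m : ℕ} → (Fin m → Fin m → ℤ) → List (Fin m) → Set
Chain w []           = ⊤
Chain w (x ∷ [])     = ⊤
Chain w (x ∷ y ∷ xs) = Adj w x y × Chain w (y ∷ xs)

Connected : {m : ℕ} → (Fin m → Fin m → ℤ) → Set
Connected w = ∀ i j → i ≡ j ⊎ Σ (List _) (λ p → Chain w (i ∷ p ++ j ∷ []))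

Acyclic : {m : ℕ} → (Fin m → Fin m → ℤ) → Set
Acyclic w = ∀ x y c → 1 ≤ length c → Unique (x ∷ c ++ y ∷ []) →
            Chain w (x ∷ c ++ y ∷ []) → ¬ Adj w y x

IsSignedTree : {m : ℕ} → (Fin m → Fin m → ℤ) → Set
IsSignedTree w = IsSignedGraph w × Connected w × Acyclic w

-- underlying graph is the cycle v₁ v₂ … vₙ v₁  (vertex vᵢ₊₁ = index i)
CycAdj : (n : ℕ) → Fin n → Fin n → Set
CycAdj n i j = toℕ j ≡ suc (toℕ i) ⊎ toℕ i ≡ suc (toℕ j)
             ⊎ (toℕ i ≡ 0 × suc (toℕ j) ≡ n) ⊎ (toℕ j ≡ 0 × suc (toℕ i) ≡ n)

IsSignedCycle : (n : ℕ) → (Fin n → Fin n → ℤ) → Set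
IsSignedCycle n w = 3 ≤ n × IsSignedGraph w ×
  (∀ i j → (Adj w i j → CycAdj n i j) × (CycAdj n i j → Adj w i j))

-- Vertex set: Fin n ⊎ (Fin m₁ ⊎ Fin m₂)
-- (cycle, first tree, second tree).  Root r₁ is joined to v₁ (index 0)
-- by an edge of sign e₁; root r₂ is joined to v_{l+1} (index l) with sign e₂.

UV : ℕ → ℕ → ℕ → Set
UV n m₁ m₂ = Fin n ⊎ (Fin m₁ ⊎ Fin m₂)

joinW : {n m : ℕ} → Fin n → Fin m → ℤ → Fin n → Fin m → ℤ
joinW v r e i a with i ≟ᶠ v | a ≟ᶠ r
... | yes _ | yes _ = e
... | _     | _     = + 0

Uw : {n m₁ m₂ : ℕ} → (C : Fin n → Fin n → ℤ) →
     (T₁ : Fin m₁ → Fin m₁ → ℤ) → (r₁ : Fin m₁) → (e₁ : ℤ) →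
     (T₂ : Fin m₂ → Fin m₂ → ℤ) → (r₂ : Fin m₂) → (e₂ : ℤ) →
     (v₁ vₗ : Fin n) → UV n m₁ m₂ → UV n m₁ m₂ → ℤ
Uw C T₁ r₁ e₁ T₂ r₂ e₂ v₁ vₗ (inj₁ i)        (inj₁ j)        = C i j
Uw C T₁ r₁ e₁ T₂ r₂ e₂ v₁ vₗ (inj₂ (inj₁ a)) (inj₂ (inj₁ b)) = T₁ a b
Uw C T₁ r₁ e₁ T₂ r₂ e₂ v₁ vₗ (inj₂ (inj₂ a)) (inj₂ (inj₂ b)) = T₂ a b
Uw C T₁ r₁ e₁ T₂ r₂ e₂ v₁ vₗ (inj₁ i)        (inj₂ (inj₁ a)) = joinW v₁ r₁ e₁ i a
Uw C T₁ r₁ e₁ T₂ r₂ e₂ v₁ vₗ (inj₂ (inj₁ a)) (inj₁ i)        = joinW v₁ r₁ e₁ i a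
Uw C T₁ r₁ e₁ T₂ r₂ e₂ v₁ vₗ (inj₁ i)        (inj₂ (inj₂ a)) = joinW vₗ r₂ e₂ i a
Uw C T₁ r₁ e₁ T₂ r₂ e₂ v₁ vₗ (inj₂ (inj₂ a)) (inj₁ i)        = joinW vₗ r₂ e₂ i a
Uw C T₁ r₁ e₁ T₂ r₂ e₂ v₁ vₗ (inj₂ (inj₁ a)) (inj₂ (inj₂ b)) = + 0
Uw C T₁ r₁ e₁ T₂ r₂ e₂ v₁ vₗ (inj₂ (inj₂ a)) (inj₂ (inj₁ b)) = + 0

cycV : (n m₁ m₂ : ℕ) → List (UV n m₁ m₂)
cycV n m₁ m₂ = map inj₁ (allFin n)

tree₁V : (n m₁ m₂ : ℕ) → List (UV n m₁ m₂)
tree₁V n m₁ m₂ = map (λ a → inj₂ (inj₁ a)) (allFin m₁)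

tree₂V : (n m₁ m₂ : ℕ) → List (UV n m₁ m₂)
tree₂V n m₁ m₂ = map (λ a → inj₂ (inj₂ a)) (allFin m₂)

-- Pₙ₋₁ = Cₙ ∖ v₁ : cycle vertices with index ≥ 1
pathAllV : (n m₁ m₂ : ℕ) → List (UV n m₁ m₂)
pathAllV n m₁ m₂ = map inj₁ (filter (λ i → 1 ≤? toℕ i) (allFin n))

-- P_{l-1} : v₂ … v_l  (indices 1 … l-1)
path₁V : (n m₁ m₂ l : ℕ) → List (UV n m₁ m₂)
path₁V n m₁ m₂ l = map inj₁ (filter (λ i → (1 ≤? toℕ i) ×-dec (toℕ i <? l)) (allFin n))

-- P_{n-l-1} : v_{l+2} … vₙ  (indices l+1 … n-1)
path₂V : (n m₁ m₂ l : ℕ) → List (UV n m₁ m₂)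
path₂V n m₁ m₂ l = map inj₁ (filter (λ i → l <? toℕ i) (allFin n))

-- A cut edge ab, the only edge joining the vertex sets A ∋ a and B ∋ b, expands the
-- permanent as per (A ∪ B) = per A · per B + w(a,b) w(b,a) · per (A − a) · per (B − b).
-- For the edge r₁v₁ this gives
--   per U = per T₁ · per (Cₙ ∪ T₂) + e₁² · per (T₁ − r₁) · per (Pₙ₋₁ ∪ T₂),
-- and for the edge r₂v_{l+1} of Pₙ₋₁ ∪ T₂, whose two paths Pₗ₋₁ and Pₙ₋ₗ₋₁ are not joined,
--   per (Pₙ₋₁ ∪ T₂) = per T₂ · per Pₙ₋₁ + e₂² · per (T₂ − r₂) · per Pₗ₋₁ · per Pₙ₋ₗ₋₁.
-- The same expansion with B = {v} gives per {T, v} = e² · per (T − r), a single vertex having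
-- permanent 0. The permanent is handled through its row-by-row recursive form, identified
-- with the sum over permutations by Laplace expansion along the first row.

module Submission where

open import Defs
open import Data.Nat using (ℕ; zero; suc; _≤_; _<_; _∸_; _≤?_; _<?_; s≤s; z≤n)
open import Data.Nat.Properties using (≤-trans)
import Data.Nat.Properties as ℕ
open import Data.Integer as ℤ using (ℤ; +_; _+_; _*_)
open import Data.Integer.Properties using (+-commutativeSemigroup; *-commutativeSemigroup; *-zeroˡ; *-zeroʳ; *-identityˡ; +-identityˡ; +-identityʳ; +-assoc; *-assoc; *-distribˡ-+; *-distribʳ-+)
open import Data.Integer.Tactic.RingSolver using (solve-∀)
import Algebra.Properties.CommutativeSemigroup as CommutativeSemigroup
open CommutativeSemigroup +-commutativeSemigroup using () renaming (interchange to +-interchange; x∙yz≈y∙xz to +-exchange)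
open CommutativeSemigroup *-commutativeSemigroup using () renaming (x∙yz≈y∙xz to *-exchange)
open import Data.Fin using (Fin; toℕ; fromℕ<; punchIn) renaming (zero to fzero; suc to fsuc)
open import Data.Fin.Properties using (toℕ-fromℕ<; toℕ-injective; punchIn-injective; suc-injective) renaming (_≟_ to _≟ᶠ_)
open import Data.List using (List; []; _∷_; _++_; map; filter; concatMap; allFin; tabulate; length)
import Data.List as List
open import Data.List.Properties using (map-tabulate; map-∘; map-cong; map-++; length-map; ++-assoc; concatMap-map; map-concatMap; concatMap-cong; tabulate-lookup; filter-++; filter-≐; filter-none; filter-all; filter-accept; filter-reject)
open import Data.List.Membership.Propositional using (_∈_)
open import Data.List.Membership.Propositional.Properties using (∈-map⁻; ∈-++⁻; ∈-++⁺ˡ; ∈-++⁺ʳ; ∈-filter⁻; ∈-filter⁺; ∈-allFin)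
open import Data.List.Relation.Unary.Any using (here; there)
open import Data.List.Relation.Unary.All as All using (All; all?; _∷_)
import Data.List.Relation.Unary.All.Properties as Allₚ
open import Data.List.Relation.Unary.AllPairs as AllPairs using ([]; _∷_)
open import Data.List.Relation.Unary.Unique.Propositional using (Unique)
import Data.List.Relation.Unary.Unique.Propositional.Properties as Uniqueₚ
import Data.List.Relation.Unary.Unique.DecPropositional as UniqueDec
open import Data.List.Relation.Binary.Permutation.Propositional using (_↭_; refl; prep; swap; trans; ↭-sym; ↭-reflexive; ↭⇒↭ₛ; module PermutationReasoning)
open import Data.List.Relation.Binary.Permutation.Propositional.Properties using (map⁺; shift; shifts; ++-comm; ++⁺; ++⁺ʳ; ∈-resp-↭; ↭-length; ¬x∷xs↭[])
import Data.List.Relation.Binary.Permutation.Setoid.Properties as SetoidPerm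
open import Data.Vec as Vec using (Vec; toList)
open import Data.Vec.Properties using (toList-map; lookup-map)
open import Data.Product using (_×_; _,_; proj₁; proj₂; ∃)
open import Data.Sum as Sum using (_⊎_; inj₁; inj₂; [_,_])
open import Data.Sum.Properties using (≡-dec; inj₁-injective; inj₂-injective)
open import Data.Empty using (⊥; ⊥-elim)
open import Function using (id; _∘_)
open import Level using (0ℓ)
open import Relation.Nullary using (¬_; Dec; yes; no; ¬?)
open import Relation.Nullary.Decidable using (_×-dec_)
open import Relation.Unary using (Pred; Decidable)
open import Relation.Unary.Properties using (_∩?_)
open import Relation.Binary.Definitions using (DecidableEquality)
open import Relation.Binary.PropositionalEquality using (_≡_; _≢_; cong; cong₂; sym; subst; setoid; module ≡-Reasoning)
  renaming (refl to ≡-refl; trans to ≡-trans)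

filter-map : ∀ {A B : Set} {P : Pred B 0ℓ} (P? : Decidable P) (f : A → B) xs →
             filter P? (map f xs) ≡ map f (filter (P? ∘ f) xs)
filter-map P? f []       = ≡-refl
filter-map P? f (x ∷ xs) with P? (f x)
... | yes _ = cong (f x ∷_) (filter-map P? f xs)
... | no  _ = filter-map P? f xs

filter-concatMap : ∀ {A B : Set} {P : Pred B 0ℓ} (P? : Decidable P) (g : A → List B) xs →
                   filter P? (concatMap g xs) ≡ concatMap (filter P? ∘ g) xs
filter-concatMap P? g []       = ≡-refl
filter-concatMap P? g (x ∷ xs) =
  ≡-trans (filter-++ P? (g x) (concatMap g xs)) (cong (filter P? (g x) ++_) (filter-concatMap P? g xs))

concatMap-filter : ∀ {A B : Set} {P : Pred A 0ℓ} (P? : Decidable P) (g h : A → List B) xs →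
                   (∀ {y} → ¬ P y → g y ≡ []) → (∀ {y} → P y → g y ≡ h y) →
                   concatMap g xs ≡ concatMap h (filter P? xs)
concatMap-filter P? g h []       _     _  = ≡-refl
concatMap-filter P? g h (x ∷ xs) empty eq with P? x
... | yes px = cong₂ _++_ (eq px) (concatMap-filter P? g h xs empty eq)
... | no ¬px = ≡-trans (cong (_++ concatMap g xs) (empty ¬px)) (concatMap-filter P? g h xs empty eq)

filter-filter : ∀ {A : Set} {P Q : Pred A 0ℓ} (P? : Decidable P) (Q? : Decidable Q) xs →
                filter P? (filter Q? xs) ≡ filter (P? ∩? Q?) xs
filter-filter P? Q? []       = ≡-refl
filter-filter P? Q? (x ∷ xs) with Q? x | P? x
... | yes _ | yes p = ≡-trans (filter-accept P? p) (cong (x ∷_) (filter-filter P? Q? xs))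
... | yes _ | no ¬p = ≡-trans (filter-reject P? ¬p) (filter-filter P? Q? xs)
... | no  _ | yes _ = filter-filter P? Q? xs
... | no  _ | no  _ = filter-filter P? Q? xs

↭-partition : ∀ {A : Set} {P : Pred A 0ℓ} (P? : Decidable P) xs → xs ↭ filter P? xs ++ filter (¬? ∘ P?) xs
↭-partition P? []       = refl
↭-partition P? (x ∷ xs) with P? x
... | yes _ = prep x (↭-partition P? xs)
... | no  _ = trans (prep x (↭-partition P? xs)) (↭-sym (shift x _ _))

shift∷ : ∀ {X : Set} (y x : X) ys zs → y ∷ ys ++ x ∷ zs ↭ x ∷ y ∷ ys ++ zs
shift∷ y x ys zs = trans (prep y (shift x ys zs)) (swap y x refl)

unique-↭ : ∀ {A : Set} {xs ys : List A} → xs ↭ ys → Unique xs → Unique ys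
unique-↭ p = SetoidPerm.Unique-resp-↭ (setoid _) (↭⇒↭ₛ p)

unique-++ˡ : ∀ {A : Set} (xs : List A) {ys} → Unique (xs ++ ys) → Unique xs
unique-++ˡ []       _             = []
unique-++ˡ (x ∷ xs) (x-fresh ∷ u) = Allₚ.++⁻ˡ xs x-fresh ∷ unique-++ˡ xs u

unique-++ʳ : ∀ {A : Set} (xs : List A) {ys} → Unique (xs ++ ys) → Unique ys
unique-++ʳ []       u       = u
unique-++ʳ (x ∷ xs) (_ ∷ u) = unique-++ʳ xs u

unique-truncate : ∀ {A : Set} (xs : List A) y zs → Unique (xs ++ y ∷ zs) → Unique (xs ++ y ∷ [])
unique-truncate xs y zs u = unique-++ˡ (xs ++ y ∷ []) (subst Unique (sym (++-assoc xs (y ∷ []) zs)) u)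

module _ {A : Set} (_≟_ : DecidableEquality A) where

  extract : ∀ {x xs} → Unique xs → x ∈ xs → xs ↭ x ∷ filter (λ y → ¬? (x ≟ y)) xs
  extract {xs = y ∷ ys} (y-fresh ∷ _) (here ≡-refl) = prep y (↭-reflexive (sym (≡-trans
    (filter-reject (λ z → ¬? (y ≟ z)) (λ y≢y → y≢y ≡-refl))
    (filter-all (λ z → ¬? (y ≟ z)) y-fresh))))
  extract {x} {y ∷ ys} (y-fresh ∷ u) (there x∈ys) =
    trans (prep y (extract u x∈ys))
          (trans (swap y x refl) (prep x (↭-reflexive (sym (filter-accept (λ z → ¬? (x ≟ z)) x≢y)))))
    where
    x≢y : ¬ x ≡ y
    x≢y x≡y = All.lookup y-fresh x∈ys (sym x≡y)

-- Sums over selections and the row-by-row permanent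

module _ {A : Set} where

  -- sumPicks h xs is the sum, over the positions of an entry c of xs, of h c (xs with that entry removed)
  sumPicks : (A → List A → ℤ) → List A → ℤ
  sumPicks h []       = + 0
  sumPicks h (x ∷ xs) = h x xs + sumPicks (λ c r → h c (x ∷ r)) xs

  sumPicks-cong : ∀ {h h′ : A → List A → ℤ} xs →
                  (∀ c r → c ∷ r ↭ xs → h c r ≡ h′ c r) → sumPicks h xs ≡ sumPicks h′ xs
  sumPicks-cong []       eq = ≡-refl
  sumPicks-cong (x ∷ xs) eq = cong₂ _+_ (eq x xs refl)
    (sumPicks-cong xs (λ c r p → eq c (x ∷ r) (trans (swap c x refl) (prep x p))))

  sumPicks-ext : ∀ {h h′ : A → List A → ℤ} xs → (∀ c r → h c r ≡ h′ c r) →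
                 sumPicks h xs ≡ sumPicks h′ xs
  sumPicks-ext xs eq = sumPicks-cong xs (λ c r _ → eq c r)

  sumPicks-zero : ∀ {h : A → List A → ℤ} xs → (∀ c r → c ∷ r ↭ xs → h c r ≡ + 0) →
                  sumPicks h xs ≡ + 0
  sumPicks-zero xs eq = ≡-trans (sumPicks-cong xs eq) (zeros xs)
    where
    zeros : ∀ xs → sumPicks (λ _ _ → + 0) xs ≡ + 0
    zeros []       = ≡-refl
    zeros (x ∷ xs) = ≡-trans (+-identityˡ _) (zeros xs)

  sumPicks-+ : ∀ (h g : A → List A → ℤ) xs →
               sumPicks (λ c r → h c r + g c r) xs ≡ sumPicks h xs + sumPicks g xs
  sumPicks-+ h g []       = ≡-refl
  sumPicks-+ h g (x ∷ xs) =
    ≡-trans (cong (λ z → h x xs + g x xs + z) (sumPicks-+ _ _ xs)) (+-interchange (h x xs) (g x xs) _ _)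

  sumPicks-*ˡ : ∀ k (h : A → List A → ℤ) xs →
                sumPicks (λ c r → k * h c r) xs ≡ k * sumPicks h xs
  sumPicks-*ˡ k h []       = sym (*-zeroʳ k)
  sumPicks-*ˡ k h (x ∷ xs) =
    ≡-trans (cong (λ z → k * h x xs + z) (sumPicks-*ˡ k _ xs)) (sym (*-distribˡ-+ k (h x xs) _))

  sumPicks-*ʳ : ∀ k (h : A → List A → ℤ) xs →
                sumPicks (λ c r → h c r * k) xs ≡ sumPicks h xs * k
  sumPicks-*ʳ k h []       = sym (*-zeroˡ k)
  sumPicks-*ʳ k h (x ∷ xs) =
    ≡-trans (cong (λ z → h x xs * k + z) (sumPicks-*ʳ k _ xs)) (sym (*-distribʳ-+ k (h x xs) _))

  sumPicks-++ : ∀ (h : A → List A → ℤ) xs ys →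
                sumPicks h (xs ++ ys) ≡
                sumPicks (λ c r → h c (r ++ ys)) xs + sumPicks (λ c r → h c (xs ++ r)) ys
  sumPicks-++ h []       ys = sym (+-identityˡ _)
  sumPicks-++ h (x ∷ xs) ys =
    ≡-trans (cong (λ z → h x (xs ++ ys) + z) (sumPicks-++ _ xs ys)) (sym (+-assoc (h x (xs ++ ys)) _ _))

  sumPicks-↭ : ∀ (h : A → List A → ℤ) {xs ys} → (∀ c {r r′} → r ↭ r′ → h c r ≡ h c r′) →
               xs ↭ ys → sumPicks h xs ≡ sumPicks h ys
  sumPicks-↭ h resp refl        = ≡-refl
  sumPicks-↭ h resp (prep x p)  =
    cong₂ _+_ (resp x p) (sumPicks-↭ _ (λ c q → resp c (prep x q)) p)
  sumPicks-↭ h resp (swap {xs} {ys} x y p) = begin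
    h x (y ∷ xs) + (h y (x ∷ xs) + sumPicks (λ c r → h c (x ∷ y ∷ r)) xs)
      ≡⟨ cong₂ _+_ (resp x (prep y p)) (cong₂ _+_ (resp y (prep x p)) tails) ⟩
    h x (y ∷ ys) + (h y (x ∷ ys) + sumPicks (λ c r → h c (y ∷ x ∷ r)) ys)
      ≡⟨ +-exchange (h x (y ∷ ys)) (h y (x ∷ ys)) _ ⟩
    h y (x ∷ ys) + (h x (y ∷ ys) + sumPicks (λ c r → h c (y ∷ x ∷ r)) ys) ∎
    where
    open ≡-Reasoning
    tails : sumPicks (λ c r → h c (x ∷ y ∷ r)) xs ≡ sumPicks (λ c r → h c (y ∷ x ∷ r)) ys
    tails = ≡-trans (sumPicks-↭ _ (λ c q → resp c (prep x (prep y q))) p)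
                    (sumPicks-ext ys (λ c r → resp c (swap x y refl)))
  sumPicks-↭ h resp (trans p q) = ≡-trans (sumPicks-↭ h resp p) (sumPicks-↭ h resp q)

sumPicks-map : ∀ {A B : Set} (g : B → A) (h : A → List A → ℤ) xs →
               sumPicks h (map g xs) ≡ sumPicks (λ c r → h (g c) (map g r)) xs
sumPicks-map g h []       = ≡-refl
sumPicks-map g h (x ∷ xs) = cong (λ z → h (g x) (map g xs) + z) (sumPicks-map g _ xs)

module _ {A : Set} where

  -- the permanent of the matrix whose rows are fs, restricted to the columns cs
  -- (zero when the numbers of rows and columns differ)
  perₗ : List (A → ℤ) → List A → ℤ
  perₗ []       []      = + 1
  perₗ []       (_ ∷ _) = + 0
  perₗ (f ∷ fs) cs      = sumPicks (λ c r → f c * perₗ fs r) cs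

  perₗ-↭ᶜ : ∀ fs {cs cs′ : List A} → cs ↭ cs′ → perₗ fs cs ≡ perₗ fs cs′
  perₗ-↭ᶜ []       {[]}    {[]}    p = ≡-refl
  perₗ-↭ᶜ []       {[]}    {_ ∷ _} p = ⊥-elim (¬x∷xs↭[] (↭-sym p))
  perₗ-↭ᶜ []       {_ ∷ _} {[]}    p = ⊥-elim (¬x∷xs↭[] p)
  perₗ-↭ᶜ []       {_ ∷ _} {_ ∷ _} p = ≡-refl
  perₗ-↭ᶜ (f ∷ fs) p = sumPicks-↭ _ (λ c q → cong (f c *_) (perₗ-↭ᶜ fs q)) p

  private
    rowSum : (A → ℤ) → (List A → ℤ) → List A → ℤ
    rowSum g Q = sumPicks (λ d r → g d * Q r)

    rowSum₂ : (A → ℤ) → (A → ℤ) → (List A → ℤ) → List A → ℤ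
    rowSum₂ f g Q = sumPicks (λ c r → f c * rowSum g Q r)

    rowSum₂-∷ : ∀ f g Q x xs → rowSum₂ f g Q (x ∷ xs) ≡
                f x * rowSum g Q xs + (g x * rowSum f Q xs + rowSum₂ f g (λ r → Q (x ∷ r)) xs)
    rowSum₂-∷ f g Q x xs = cong (λ z → f x * rowSum g Q xs + z) (begin
      sumPicks (λ c r → f c * (g x * Q r + rowSum g (λ r′ → Q (x ∷ r′)) r)) xs
        ≡⟨ sumPicks-ext xs (λ c r → *-distribˡ-+ (f c) _ _) ⟩
      sumPicks (λ c r → f c * (g x * Q r) + f c * rowSum g (λ r′ → Q (x ∷ r′)) r) xs
        ≡⟨ sumPicks-+ _ _ xs ⟩
      sumPicks (λ c r → f c * (g x * Q r)) xs + rowSum₂ f g (λ r → Q (x ∷ r)) xs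
        ≡⟨ cong (_+ rowSum₂ f g (λ r → Q (x ∷ r)) xs)
             (≡-trans (sumPicks-ext xs (λ c r → *-exchange (f c) (g x) (Q r))) (sumPicks-*ˡ (g x) _ xs)) ⟩
      g x * rowSum f Q xs + rowSum₂ f g (λ r → Q (x ∷ r)) xs ∎)
      where open ≡-Reasoning

    rowSum₂-comm : ∀ f g Q xs → rowSum₂ f g Q xs ≡ rowSum₂ g f Q xs
    rowSum₂-comm f g Q []       = ≡-refl
    rowSum₂-comm f g Q (x ∷ xs) = begin
      rowSum₂ f g Q (x ∷ xs)
        ≡⟨ rowSum₂-∷ f g Q x xs ⟩
      f x * rowSum g Q xs + (g x * rowSum f Q xs + rowSum₂ f g (λ r → Q (x ∷ r)) xs)
        ≡⟨ cong (λ z → f x * rowSum g Q xs + (g x * rowSum f Q xs + z)) (rowSum₂-comm f g _ xs) ⟩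
      f x * rowSum g Q xs + (g x * rowSum f Q xs + rowSum₂ g f (λ r → Q (x ∷ r)) xs)
        ≡⟨ +-exchange (f x * rowSum g Q xs) (g x * rowSum f Q xs) _ ⟩
      g x * rowSum f Q xs + (f x * rowSum g Q xs + rowSum₂ g f (λ r → Q (x ∷ r)) xs)
        ≡⟨ sym (rowSum₂-∷ g f Q x xs) ⟩
      rowSum₂ g f Q (x ∷ xs) ∎
      where open ≡-Reasoning

  perₗ-↭ʳ : ∀ {fs gs : List (A → ℤ)} → fs ↭ gs → ∀ cs → perₗ fs cs ≡ perₗ gs cs
  perₗ-↭ʳ refl         cs = ≡-refl
  perₗ-↭ʳ (prep f p)   cs = sumPicks-ext cs (λ c r → cong (f c *_) (perₗ-↭ʳ p r))
  perₗ-↭ʳ (swap {fs} f g p) cs = ≡-trans (rowSum₂-comm f g (perₗ fs) cs)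
    (sumPicks-ext cs (λ c r → cong (g c *_) (sumPicks-ext r (λ d r′ → cong (f d *_) (perₗ-↭ʳ p r′)))))
  perₗ-↭ʳ (trans p q)  cs = ≡-trans (perₗ-↭ʳ p cs) (perₗ-↭ʳ q cs)

  perₗ-cong-head : ∀ {f g} fs (cs : List A) → (∀ {c} → c ∈ cs → f c ≡ g c) →
                   perₗ (f ∷ fs) cs ≡ perₗ (g ∷ fs) cs
  perₗ-cong-head fs cs eq =
    sumPicks-cong cs (λ c r p → cong (_* perₗ fs r) (eq (∈-resp-↭ p (here ≡-refl))))

  perₗ-length : ∀ fs (cs : List A) → length fs ≢ length cs → perₗ fs cs ≡ + 0
  perₗ-length []       []      ne = ⊥-elim (ne ≡-refl)
  perₗ-length []       (_ ∷ _) ne = ≡-refl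
  perₗ-length (f ∷ fs) cs      ne = sumPicks-zero cs (λ c r p →
    ≡-trans (cong (f c *_) (perₗ-length fs r (λ eq → ne (≡-trans (cong suc eq) (↭-length p)))))
            (*-zeroʳ (f c)))

  Vanish : List (A → ℤ) → List A → Set
  Vanish fs cs = ∀ {f c} → f ∈ fs → c ∈ cs → f c ≡ + 0

  perₗ-zeroColumn : ∀ fs {c} (cs : List A) → c ∈ cs → (∀ {f} → f ∈ fs → f c ≡ + 0) → perₗ fs cs ≡ + 0
  perₗ-zeroColumn []       (_ ∷ _) _ _ = ≡-refl
  perₗ-zeroColumn (f ∷ fs) {c} cs c∈cs vanish = sumPicks-zero cs (λ d r p → term d r (∈-resp-↭ (↭-sym p) c∈cs))
    where
    term : ∀ d r → c ∈ d ∷ r → f d * perₗ fs r ≡ + 0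
    term d r (here ≡-refl) = ≡-trans (cong (_* perₗ fs r) (vanish (here ≡-refl))) (*-zeroˡ (perₗ fs r))
    term d r (there c∈r)   =
      ≡-trans (cong (f d *_) (perₗ-zeroColumn fs r c∈r (vanish ∘ there))) (*-zeroʳ (f d))

  perₗ-block : ∀ fs gs (cs ds : List A) → Vanish fs ds → Vanish gs cs →
               perₗ (fs ++ gs) (cs ++ ds) ≡ perₗ fs cs * perₗ gs ds
  perₗ-block []       gs []       ds _ _ = sym (*-identityˡ _)
  perₗ-block []       gs (c ∷ cs) ds _ gs⊥cs = ≡-trans
    (perₗ-zeroColumn gs (c ∷ cs ++ ds) (here ≡-refl) (λ g∈gs → gs⊥cs g∈gs (here ≡-refl)))
    (sym (*-zeroˡ (perₗ gs ds)))
  perₗ-block (f ∷ fs) gs cs ds fs⊥ds gs⊥cs = begin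
    sumPicks (λ c r → f c * perₗ (fs ++ gs) r) (cs ++ ds)
      ≡⟨ sumPicks-++ _ cs ds ⟩
    sumPicks (λ c r → f c * perₗ (fs ++ gs) (r ++ ds)) cs + sumPicks (λ c r → f c * perₗ (fs ++ gs) (cs ++ r)) ds
      ≡⟨ cong₂ _+_ split noTerms ⟩
    perₗ (f ∷ fs) cs * perₗ gs ds + + 0
      ≡⟨ +-identityʳ _ ⟩
    perₗ (f ∷ fs) cs * perₗ gs ds ∎
    where
    open ≡-Reasoning
    split : sumPicks (λ c r → f c * perₗ (fs ++ gs) (r ++ ds)) cs ≡ perₗ (f ∷ fs) cs * perₗ gs ds
    split = ≡-trans (sumPicks-cong cs (λ c r p →
        ≡-trans (cong (f c *_) (perₗ-block fs gs r ds (λ f∈fs → fs⊥ds (there f∈fs))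
                                 (λ g∈gs d∈r → gs⊥cs g∈gs (∈-resp-↭ p (there d∈r)))))
                (sym (*-assoc (f c) _ _))))
      (sumPicks-*ʳ (perₗ gs ds) _ cs)
    noTerms : sumPicks (λ c r → f c * perₗ (fs ++ gs) (cs ++ r)) ds ≡ + 0
    noTerms = sumPicks-zero ds (λ d r p →
      ≡-trans (cong (_* perₗ (fs ++ gs) (cs ++ r)) (fs⊥ds (here ≡-refl) (∈-resp-↭ p (here ≡-refl))))
              (*-zeroˡ (perₗ (fs ++ gs) (cs ++ r))))

  perₗ-splitColumn : ∀ f g fs b (cs : List A) → g b ≡ + 0 → (∀ {c} → c ∈ cs → f c ≡ g c) →
                     perₗ (f ∷ fs) (b ∷ cs) ≡ perₗ (g ∷ fs) (b ∷ cs) + f b * perₗ fs cs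
  perₗ-splitColumn f g fs b cs gb≡0 f≗g = begin
    f b * perₗ fs cs + rest f
      ≡⟨ cong (λ z → f b * perₗ fs cs + z)
           (sumPicks-cong cs (λ c r p → cong (_* perₗ fs (b ∷ r)) (f≗g (∈-resp-↭ p (here ≡-refl))))) ⟩
    f b * perₗ fs cs + rest g
      ≡⟨ rearrange (f b * perₗ fs cs) (perₗ fs cs) (rest g) ⟩
    + 0 * perₗ fs cs + rest g + f b * perₗ fs cs
      ≡⟨ cong (λ z → z * perₗ fs cs + rest g + f b * perₗ fs cs) (sym gb≡0) ⟩
    g b * perₗ fs cs + rest g + f b * perₗ fs cs ∎
    where
    open ≡-Reasoning
    rest : (A → ℤ) → ℤ
    rest h = sumPicks (λ c r → h c * perₗ fs (b ∷ r)) cs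
    rearrange : ∀ a p q → a + q ≡ + 0 * p + q + a
    rearrange = solve-∀

-- The permanent as a sum over permutations

allFin-suc : ∀ m → allFin (suc m) ≡ fzero ∷ map fsuc (allFin m)
allFin-suc m = cong (fzero ∷_) (sym (map-tabulate id fsuc))

allFin-without : ∀ m (x : Fin (suc m)) →
                 filter (λ y → ¬? (x ≟ᶠ y)) (allFin (suc m)) ≡ map (punchIn x) (allFin m)
allFin-without m fzero = begin
  filter (λ y → ¬? (fzero ≟ᶠ y)) (allFin (suc m))
    ≡⟨ cong (filter (λ y → ¬? (fzero ≟ᶠ y))) (allFin-suc m) ⟩
  filter (λ y → ¬? (fzero ≟ᶠ y)) (map fsuc (allFin m))
    ≡⟨ filter-map (λ y → ¬? (fzero ≟ᶠ y)) fsuc (allFin m) ⟩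
  map fsuc (filter (λ y → ¬? (fzero ≟ᶠ fsuc y)) (allFin m))
    ≡⟨ cong (map fsuc) (filter-all (λ y → ¬? (fzero ≟ᶠ fsuc y)) (All.universal (λ _ ()) (allFin m))) ⟩
  map fsuc (allFin m) ∎
  where open ≡-Reasoning
allFin-without (suc m) (fsuc x) = begin
  filter (λ y → ¬? (fsuc x ≟ᶠ y)) (allFin (suc (suc m)))
    ≡⟨ cong (filter (λ y → ¬? (fsuc x ≟ᶠ y))) (allFin-suc (suc m)) ⟩
  fzero ∷ filter (λ y → ¬? (fsuc x ≟ᶠ y)) (map fsuc (allFin (suc m)))
    ≡⟨ cong (fzero ∷_) (filter-map (λ y → ¬? (fsuc x ≟ᶠ y)) fsuc (allFin (suc m))) ⟩
  fzero ∷ map fsuc (filter (λ y → ¬? (fsuc x ≟ᶠ fsuc y)) (allFin (suc m)))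
    ≡⟨ cong (λ ys → fzero ∷ map fsuc ys) (filter-≐ (λ y → ¬? (fsuc x ≟ᶠ fsuc y)) (λ y → ¬? (x ≟ᶠ y))
         ((λ ne eq → ne (cong fsuc eq)) , (λ ne eq → ne (suc-injective eq))) (allFin (suc m))) ⟩
  fzero ∷ map fsuc (filter (λ y → ¬? (x ≟ᶠ y)) (allFin (suc m)))
    ≡⟨ cong (λ ys → fzero ∷ map fsuc ys) (allFin-without m x) ⟩
  fzero ∷ map fsuc (map (punchIn x) (allFin m))
    ≡⟨ cong (fzero ∷_) (≡-trans (sym (map-∘ (allFin m))) (map-∘ (allFin m))) ⟩
  map (punchIn (fsuc x)) (fzero ∷ map fsuc (allFin m))
    ≡⟨ cong (map (punchIn (fsuc x))) (sym (allFin-suc m)) ⟩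
  map (punchIn (fsuc x)) (allFin (suc m)) ∎
  where open ≡-Reasoning

module _ {k m : ℕ} where

  Avoids : Fin m → Vec (Fin m) k → Set
  Avoids x v = All (λ y → ¬ x ≡ y) (toList v)

  avoids? : ∀ x v → Dec (Avoids x v)
  avoids? x v = all? (λ y → ¬? (x ≟ᶠ y)) (toList v)

allVecs-avoiding : ∀ k m (x : Fin (suc m)) →
                   filter (avoids? x) (allVecs k (suc m)) ≡ map (Vec.map (punchIn x)) (allVecs k m)
allVecs-avoiding zero    m x = ≡-refl
allVecs-avoiding (suc k) m x = begin
  filter (avoids? x) (concatMap (λ y → map (y Vec.∷_) (allVecs k (suc m))) (allFin (suc m)))
    ≡⟨ filter-concatMap (avoids? x) (λ y → map (y Vec.∷_) (allVecs k (suc m))) (allFin (suc m)) ⟩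
  concatMap (λ y → filter (avoids? x) (map (y Vec.∷_) (allVecs k (suc m)))) (allFin (suc m))
    ≡⟨ concatMap-filter (λ y → ¬? (x ≟ᶠ y)) _ extend (allFin (suc m)) sameAsX differentFromX ⟩
  concatMap extend (filter (λ y → ¬? (x ≟ᶠ y)) (allFin (suc m)))
    ≡⟨ cong (concatMap extend) (allFin-without m x) ⟩
  concatMap extend (map (punchIn x) (allFin m))
    ≡⟨ concatMap-map extend (punchIn x) (allFin m) ⟩
  concatMap (λ z → map (punchIn x z Vec.∷_) (map (Vec.map (punchIn x)) (allVecs k m))) (allFin m)
    ≡⟨ concatMap-cong (λ z → ≡-trans (sym (map-∘ (allVecs k m))) (map-∘ (allVecs k m))) (allFin m) ⟨
  concatMap (λ z → map (Vec.map (punchIn x)) (map (z Vec.∷_) (allVecs k m))) (allFin m)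
    ≡⟨ map-concatMap (Vec.map (punchIn x)) (λ z → map (z Vec.∷_) (allVecs k m)) (allFin m) ⟨
  map (Vec.map (punchIn x)) (concatMap (λ z → map (z Vec.∷_) (allVecs k m)) (allFin m)) ∎
  where
  open ≡-Reasoning
  extend : Fin (suc m) → List (Vec (Fin (suc m)) (suc k))
  extend y = map (y Vec.∷_) (map (Vec.map (punchIn x)) (allVecs k m))
  sameAsX : ∀ {y} → ¬ ¬ x ≡ y → filter (avoids? x) (map (y Vec.∷_) (allVecs k (suc m))) ≡ []
  sameAsX ¬x≢y = ≡-trans (filter-map (avoids? x) (_ Vec.∷_) (allVecs k (suc m)))
    (cong (map _) (filter-none (λ v → avoids? x (_ Vec.∷ v)) (All.universal (λ v a → ¬x≢y (All.head a)) (allVecs k (suc m)))))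
  differentFromX : ∀ {y} → ¬ x ≡ y → filter (avoids? x) (map (y Vec.∷_) (allVecs k (suc m))) ≡ extend y
  differentFromX x≢y = ≡-trans (filter-map (avoids? x) (_ Vec.∷_) (allVecs k (suc m)))
    (cong (map _) (≡-trans (filter-≐ (λ v → avoids? x (_ Vec.∷ v)) (avoids? x)
                              (All.tail , (x≢y ∷_)) (allVecs k (suc m)))
                            (allVecs-avoiding k m x)))

unique? : ∀ {k m} (v : Vec (Fin m) k) → Dec (Unique (toList v))
unique? v = UniqueDec.unique? _≟ᶠ_ (toList v)

perms-suc : ∀ k → perms (suc k) ≡
            concatMap (λ x → map (x Vec.∷_) (map (Vec.map (punchIn x)) (perms k))) (allFin (suc k))
perms-suc k = ≡-trans (filter-concatMap unique? (λ x → map (x Vec.∷_) (allVecs k (suc k))) (allFin (suc k)))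
                      (concatMap-cong startingWith (allFin (suc k)))
  where
  open ≡-Reasoning
  startingWith : ∀ x → filter unique? (map (x Vec.∷_) (allVecs k (suc k)))
                       ≡ map (x Vec.∷_) (map (Vec.map (punchIn x)) (perms k))
  startingWith x = begin
    filter unique? (map (x Vec.∷_) (allVecs k (suc k)))
      ≡⟨ filter-map unique? (x Vec.∷_) (allVecs k (suc k)) ⟩
    map (x Vec.∷_) (filter (unique? ∘ (x Vec.∷_)) (allVecs k (suc k)))
      ≡⟨ cong (map (x Vec.∷_)) (filter-≐ (unique? ∘ (x Vec.∷_)) (unique? ∩? avoids? x)
           ((λ { (x∉v ∷ u) → u , x∉v }) , (λ (u , x∉v) → x∉v ∷ u)) (allVecs k (suc k))) ⟩
    map (x Vec.∷_) (filter (unique? ∩? avoids? x) (allVecs k (suc k)))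
      ≡⟨ cong (map (x Vec.∷_)) (filter-filter unique? (avoids? x) (allVecs k (suc k))) ⟨
    map (x Vec.∷_) (filter unique? (filter (avoids? x) (allVecs k (suc k))))
      ≡⟨ cong (map (x Vec.∷_) ∘ filter unique?) (allVecs-avoiding k k x) ⟩
    map (x Vec.∷_) (filter unique? (map (Vec.map (punchIn x)) (allVecs k k)))
      ≡⟨ cong (map (x Vec.∷_)) (filter-map unique? (Vec.map (punchIn x)) (allVecs k k)) ⟩
    map (x Vec.∷_) (map (Vec.map (punchIn x)) (filter (unique? ∘ Vec.map (punchIn x)) (allVecs k k)))
      ≡⟨ cong (map (x Vec.∷_) ∘ map (Vec.map (punchIn x)))
           (filter-≐ (unique? ∘ Vec.map (punchIn x)) unique? (unpunch , punch) (allVecs k k)) ⟩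
    map (x Vec.∷_) (map (Vec.map (punchIn x)) (perms k)) ∎
    where
    unpunch : ∀ {v} → Unique (toList (Vec.map (punchIn x) v)) → Unique (toList v)
    unpunch {v} u = Uniqueₚ.map⁻ (subst Unique (toList-map (punchIn x) v) u)
    punch : ∀ {v} → Unique (toList v) → Unique (toList (Vec.map (punchIn x) v))
    punch {v} u = subst Unique (sym (toList-map (punchIn x) v))
                        (Uniqueₚ.map⁺ (punchIn-injective x _ _) u)

sumℤ-++ : ∀ xs ys → sumℤ (xs ++ ys) ≡ sumℤ xs + sumℤ ys
sumℤ-++ []       ys = sym (+-identityˡ _)
sumℤ-++ (x ∷ xs) ys = ≡-trans (cong (λ z → x + z) (sumℤ-++ xs ys)) (sym (+-assoc x _ _))

sumℤ-concatMap : ∀ {A B : Set} (f : B → ℤ) (g : A → List B) xs →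
                 sumℤ (map f (concatMap g xs)) ≡ sumℤ (map (λ x → sumℤ (map f (g x))) xs)
sumℤ-concatMap f g []       = ≡-refl
sumℤ-concatMap f g (x ∷ xs) =
  ≡-trans (cong sumℤ (map-++ f (g x) (concatMap g xs)))
  (≡-trans (sumℤ-++ (map f (g x)) (map f (concatMap g xs)))
           (cong (λ z → sumℤ (map f (g x)) + z) (sumℤ-concatMap f g xs)))

sumℤ-*ˡ : ∀ {B : Set} c (f : B → ℤ) xs → sumℤ (map (λ x → c * f x) xs) ≡ c * sumℤ (map f xs)
sumℤ-*ˡ c f []       = sym (*-zeroʳ c)
sumℤ-*ˡ c f (x ∷ xs) =
  ≡-trans (cong (λ z → c * f x + z) (sumℤ-*ˡ c f xs)) (sym (*-distribˡ-+ c (f x) _))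

prodFin-cong : ∀ k {f g : Fin k → ℤ} → (∀ i → f i ≡ g i) → prodFin k f ≡ prodFin k g
prodFin-cong zero    eq = ≡-refl
prodFin-cong (suc k) eq = cong₂ _*_ (eq fzero) (prodFin-cong k (eq ∘ fsuc))

per-expand : ∀ k (M : Fin (suc k) → Fin (suc k) → ℤ) →
             per M ≡ sumℤ (map (λ x → M fzero x * per (λ i j → M (fsuc i) (punchIn x j))) (allFin (suc k)))
per-expand k M = begin
  sumℤ (map term (perms (suc k)))
    ≡⟨ cong (sumℤ ∘ map term) (perms-suc k) ⟩
  sumℤ (map term (concatMap startingWith (allFin (suc k))))
    ≡⟨ sumℤ-concatMap term startingWith (allFin (suc k)) ⟩
  sumℤ (map (λ x → sumℤ (map term (startingWith x))) (allFin (suc k)))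
    ≡⟨ cong sumℤ (map-cong minor (allFin (suc k))) ⟩
  sumℤ (map (λ x → M fzero x * per (λ i j → M (fsuc i) (punchIn x j))) (allFin (suc k))) ∎
  where
  open ≡-Reasoning
  term : Vec (Fin (suc k)) (suc k) → ℤ
  term σ = prodFin (suc k) (λ i → M i (Vec.lookup σ i))
  startingWith : Fin (suc k) → List (Vec (Fin (suc k)) (suc k))
  startingWith x = map (x Vec.∷_) (map (Vec.map (punchIn x)) (perms k))
  minor : ∀ x → sumℤ (map term (startingWith x)) ≡ M fzero x * per (λ i j → M (fsuc i) (punchIn x j))
  minor x = begin
    sumℤ (map term (startingWith x))
      ≡⟨ cong sumℤ (≡-trans (sym (map-∘ (map (Vec.map (punchIn x)) (perms k)))) (sym (map-∘ (perms k)))) ⟩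
    sumℤ (map (λ σ → term (x Vec.∷ Vec.map (punchIn x) σ)) (perms k))
      ≡⟨ cong sumℤ (map-cong (λ σ → cong (M fzero x *_) (prodFin-cong k
           (λ i → cong (M (fsuc i)) (lookup-map i (punchIn x) σ)))) (perms k)) ⟩
    sumℤ (map (λ σ → M fzero x * prodFin k (λ i → M (fsuc i) (punchIn x (Vec.lookup σ i)))) (perms k))
      ≡⟨ sumℤ-*ˡ (M fzero x) _ (perms k) ⟩
    M fzero x * per (λ i j → M (fsuc i) (punchIn x j)) ∎

sumPicks-allFin : ∀ k (h : Fin (suc k) → List (Fin (suc k)) → ℤ) →
                  sumPicks h (allFin (suc k)) ≡ sumℤ (map (λ x → h x (map (punchIn x) (allFin k))) (allFin (suc k)))
sumPicks-allFin zero    h = ≡-refl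
sumPicks-allFin (suc k) h = begin
  sumPicks h (allFin (suc (suc k)))
    ≡⟨ cong (sumPicks h) (allFin-suc (suc k)) ⟩
  h fzero (map fsuc (allFin (suc k))) + sumPicks (λ c r → h c (fzero ∷ r)) (map fsuc (allFin (suc k)))
    ≡⟨ cong (λ z → h fzero (map fsuc (allFin (suc k))) + z) (begin
         sumPicks (λ c r → h c (fzero ∷ r)) (map fsuc (allFin (suc k)))
           ≡⟨ sumPicks-map fsuc (λ c r → h c (fzero ∷ r)) (allFin (suc k)) ⟩
         sumPicks (λ c r → h (fsuc c) (fzero ∷ map fsuc r)) (allFin (suc k))
           ≡⟨ sumPicks-allFin k (λ c r → h (fsuc c) (fzero ∷ map fsuc r)) ⟩
         sumℤ (map (λ x → h (fsuc x) (fzero ∷ map fsuc (map (punchIn x) (allFin k)))) (allFin (suc k)))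
           ≡⟨ cong sumℤ (map-cong (λ x → cong (h (fsuc x)) (punchIn-suc x)) (allFin (suc k))) ⟩
         sumℤ (map (term ∘ fsuc) (allFin (suc k)))
           ≡⟨ cong sumℤ (map-∘ {g = term} {f = fsuc} (allFin (suc k))) ⟩
         sumℤ (map term (map fsuc (allFin (suc k)))) ∎) ⟩
  sumℤ (map term (fzero ∷ map fsuc (allFin (suc k))))
    ≡⟨ cong (sumℤ ∘ map term) (allFin-suc (suc k)) ⟨
  sumℤ (map term (allFin (suc (suc k)))) ∎
  where
  open ≡-Reasoning
  term : Fin (suc (suc k)) → ℤ
  term x = h x (map (punchIn x) (allFin (suc k)))
  punchIn-suc : ∀ x → fzero ∷ map fsuc (map (punchIn x) (allFin k)) ≡ map (punchIn (fsuc x)) (allFin (suc k))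
  punchIn-suc x = sym (≡-trans (cong (map (punchIn (fsuc x))) (allFin-suc k))
                               (cong (fzero ∷_) (≡-trans (sym (map-∘ (allFin k))) (map-∘ (allFin k)))))

perₗ-map : ∀ {A B : Set} (g : B → A) (fs : List (A → ℤ)) cs →
           perₗ (map (_∘ g) fs) cs ≡ perₗ fs (map g cs)
perₗ-map g []       []      = ≡-refl
perₗ-map g []       (_ ∷ _) = ≡-refl
perₗ-map g (f ∷ fs) cs      = ≡-trans (sumPicks-ext cs (λ c r → cong (f (g c) *_) (perₗ-map g fs r)))
                                      (sym (sumPicks-map g (λ c r → f c * perₗ fs r) cs))

per≡perₗ : ∀ k (M : Fin k → Fin k → ℤ) → per M ≡ perₗ (map M (allFin k)) (allFin k)
per≡perₗ zero    M = ≡-refl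
per≡perₗ (suc k) M = begin
  per M
    ≡⟨ per-expand k M ⟩
  sumℤ (map (λ x → M fzero x * per (λ i j → M (fsuc i) (punchIn x j))) (allFin (suc k)))
    ≡⟨ cong sumℤ (map-cong (λ x → cong (M fzero x *_) (minor x)) (allFin (suc k))) ⟩
  sumℤ (map (λ x → M fzero x * perₗ lowerRows (map (punchIn x) (allFin k))) (allFin (suc k)))
    ≡⟨ sumPicks-allFin k (λ c r → M fzero c * perₗ lowerRows r) ⟨
  perₗ (map M (allFin (suc k))) (allFin (suc k)) ∎
  where
  open ≡-Reasoning
  lowerRows : List (Fin (suc k) → ℤ)
  lowerRows = map M (tabulate fsuc)
  minor : ∀ x → per (λ i j → M (fsuc i) (punchIn x j)) ≡ perₗ lowerRows (map (punchIn x) (allFin k))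
  minor x = begin
    per (λ i j → M (fsuc i) (punchIn x j))
      ≡⟨ per≡perₗ k _ ⟩
    perₗ (map (λ i j → M (fsuc i) (punchIn x j)) (allFin k)) (allFin k)
      ≡⟨ cong (λ rows → perₗ rows (allFin k))
           (≡-trans (map-tabulate id (λ i j → M (fsuc i) (punchIn x j)))
                    (sym (≡-trans (sym (map-∘ {g = _∘ punchIn x} {f = M} (tabulate fsuc)))
                                  (map-tabulate fsuc (λ i → M i ∘ punchIn x))))) ⟩
    perₗ (map (_∘ punchIn x) lowerRows) (allFin k)
      ≡⟨ perₗ-map (punchIn x) lowerRows (allFin k) ⟩
    perₗ lowerRows (map (punchIn x) (allFin k)) ∎

perInd≡perₗ : ∀ {V : Set} (w : V → V → ℤ) vs → perInd w vs ≡ perₗ (map w vs) vs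
perInd≡perₗ w vs = begin
  perInd w vs
    ≡⟨ per≡perₗ (length vs) _ ⟩
  perₗ (map (λ i j → w (List.lookup vs i) (List.lookup vs j)) (allFin (length vs))) (allFin (length vs))
    ≡⟨ cong (λ rows → perₗ rows (allFin (length vs)))
         (≡-trans (map-∘ (allFin _)) (map-∘ (map (List.lookup vs) (allFin _)))) ⟩
  perₗ (map (_∘ List.lookup vs) (map w (map (List.lookup vs) (allFin (length vs))))) (allFin (length vs))
    ≡⟨ perₗ-map (List.lookup vs) (map w (map (List.lookup vs) (allFin _))) (allFin _) ⟩
  perₗ (map w (map (List.lookup vs) (allFin (length vs)))) (map (List.lookup vs) (allFin (length vs)))
    ≡⟨ cong (λ us → perₗ (map w us) us) (≡-trans (map-tabulate id (List.lookup vs)) (tabulate-lookup vs)) ⟩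
  perₗ (map w vs) vs ∎
  where open ≡-Reasoning

-- Permanents of induced subgraphs

module _ {V : Set} where

  perInd-↭ : ∀ (w : V → V → ℤ) {vs us} → vs ↭ us → perInd w vs ≡ perInd w us
  perInd-↭ w {vs} {us} p = begin
    perInd w vs              ≡⟨ perInd≡perₗ w vs ⟩
    perₗ (map w vs) vs       ≡⟨ perₗ-↭ʳ (map⁺ w p) vs ⟩
    perₗ (map w us) vs       ≡⟨ perₗ-↭ᶜ (map w us) p ⟩
    perₗ (map w us) us       ≡⟨ perInd≡perₗ w us ⟨
    perInd w us              ∎
    where open ≡-Reasoning

  NoEdges : (V → V → ℤ) → List V → List V → Set
  NoEdges w xs ys = ∀ {x y} → x ∈ xs → y ∈ ys → w x y ≡ + 0 × w y x ≡ + 0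

  rowsVanish : ∀ {w xs ys} → NoEdges w xs ys → Vanish (map w xs) ys
  rowsVanish {w} {xs} sep f∈ y∈ with ∈-map⁻ w {xs = xs} f∈
  ... | x , x∈ , ≡-refl = proj₁ (sep x∈ y∈)

  columnsVanish : ∀ {w xs ys} → NoEdges w xs ys → Vanish (map w ys) xs
  columnsVanish {w} {ys = ys} sep f∈ x∈ with ∈-map⁻ w {xs = ys} f∈
  ... | y , y∈ , ≡-refl = proj₂ (sep x∈ y∈)

  perInd-++ : ∀ w xs ys → NoEdges w xs ys → perInd w (xs ++ ys) ≡ perInd w xs * perInd w ys
  perInd-++ w xs ys sep = begin
    perInd w (xs ++ ys)
      ≡⟨ perInd≡perₗ w (xs ++ ys) ⟩
    perₗ (map w (xs ++ ys)) (xs ++ ys)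
      ≡⟨ cong (λ rows → perₗ rows (xs ++ ys)) (map-++ w xs ys) ⟩
    perₗ (map w xs ++ map w ys) (xs ++ ys)
      ≡⟨ perₗ-block (map w xs) (map w ys) xs ys (rowsVanish sep) (columnsVanish sep) ⟩
    perₗ (map w xs) xs * perₗ (map w ys) ys
      ≡⟨ cong₂ _*_ (perInd≡perₗ w xs) (perInd≡perₗ w ys) ⟨
    perInd w xs * perInd w ys ∎
    where open ≡-Reasoning

module _ {V : Set} (_≟_ : DecidableEquality V) where

  zeroAt : V → (V → ℤ) → V → ℤ
  zeroAt b f c with c ≟ b
  ... | yes _ = + 0
  ... | no  _ = f c

  zeroAt-self : ∀ b f → zeroAt b f b ≡ + 0
  zeroAt-self b f with b ≟ b
  ... | yes _   = ≡-refl
  ... | no  b≢b = ⊥-elim (b≢b ≡-refl)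

  zeroAt-other : ∀ {b c} f → c ≢ b → zeroAt b f c ≡ f c
  zeroAt-other {b} {c} f c≢b with c ≟ b
  ... | yes c≡b = ⊥-elim (c≢b c≡b)
  ... | no  _   = ≡-refl

  zeroAt-zero : ∀ {b c} f → f c ≡ + 0 → zeroAt b f c ≡ + 0
  zeroAt-zero {b} {c} f fc≡0 with c ≟ b
  ... | yes _ = ≡-refl
  ... | no  _ = fc≡0

  perₗ-deleteEntry : ∀ f fs {cs} b cs′ → cs ↭ b ∷ cs′ → (∀ {c} → c ∈ cs′ → c ≢ b) →
                     perₗ (f ∷ fs) cs ≡ perₗ (zeroAt b f ∷ fs) cs + f b * perₗ fs cs′
  perₗ-deleteEntry f fs {cs} b cs′ p b∉cs′ = begin
    perₗ (f ∷ fs) cs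
      ≡⟨ perₗ-↭ᶜ (f ∷ fs) p ⟩
    perₗ (f ∷ fs) (b ∷ cs′)
      ≡⟨ perₗ-splitColumn f (zeroAt b f) fs b cs′ (zeroAt-self b f) (λ c∈ → sym (zeroAt-other f (b∉cs′ c∈))) ⟩
    perₗ (zeroAt b f ∷ fs) (b ∷ cs′) + f b * perₗ fs cs′
      ≡⟨ cong (_+ f b * perₗ fs cs′) (perₗ-↭ᶜ (zeroAt b f ∷ fs) (↭-sym p)) ⟩
    perₗ (zeroAt b f ∷ fs) cs + f b * perₗ fs cs′ ∎
    where open ≡-Reasoning

  -- Expand row a at column b, then row b at column a. Once both entries of the edge are
  -- deleted the matrix is block diagonal; of the two mixed terms only the one using both
  -- entries survives, the other one having more rows than columns on one side.
  module CutEdge (w : V → V → ℤ) {a b : V} {As Bs : List V} (uniq : Unique (a ∷ As ++ b ∷ Bs))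
                 (sepAs : NoEdges w As (b ∷ Bs)) (sepa : NoEdges w (a ∷ []) Bs) where

    private
      Fs Gs : List (V → ℤ)
      Fs = map w As
      Gs = map w Bs
      fa⁰ fb⁰ : V → ℤ
      fa⁰ = zeroAt b (w a)
      fb⁰ = zeroAt a (w b)

      a∉ : ∀ {c} → c ∈ As ++ b ∷ Bs → c ≢ a
      a∉ c∈ c≡a = All.lookup (AllPairs.head uniq) c∈ (sym c≡a)
      a∉′ : ∀ {c} → c ∈ As ++ Bs → c ≢ a
      a∉′ c∈ = a∉ (∈-resp-↭ (↭-sym (shift b As Bs)) (there c∈))
      b∉ : ∀ {c} → c ∈ a ∷ As ++ Bs → c ≢ b
      b∉ c∈ c≡b = All.lookup (AllPairs.head (unique-↭ (shift∷ a b As Bs) uniq)) c∈ (sym c≡b)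

      Fs-vanish : Vanish Fs (b ∷ Bs)
      Fs-vanish = rowsVanish sepAs
      Gs-vanish : Vanish Gs (a ∷ As)
      Gs-vanish g∈ (here ≡-refl) = columnsVanish sepa g∈ (here ≡-refl)
      Gs-vanish g∈ (there c∈)    = columnsVanish sepAs (there g∈) c∈
      fa⁰Fs-vanish : Vanish (fa⁰ ∷ Fs) (b ∷ Bs)
      fa⁰Fs-vanish (here ≡-refl) (here ≡-refl) = zeroAt-self b (w a)
      fa⁰Fs-vanish (here ≡-refl) (there c∈)    = zeroAt-zero (w a) (proj₁ (sepa (here ≡-refl) c∈))
      fa⁰Fs-vanish (there f∈)    c∈            = Fs-vanish f∈ c∈
      fb⁰Gs-vanish : Vanish (fb⁰ ∷ Gs) (a ∷ As)
      fb⁰Gs-vanish (here ≡-refl) (here ≡-refl) = zeroAt-self a (w b)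
      fb⁰Gs-vanish (here ≡-refl) (there c∈)    = zeroAt-zero (w b) (proj₂ (sepAs c∈ (here ≡-refl)))
      fb⁰Gs-vanish (there g∈)    c∈            = Gs-vanish g∈ c∈

      tooManyRows : perₗ (fa⁰ ∷ Fs) As ≡ + 0
      tooManyRows = perₗ-length (fa⁰ ∷ Fs) As
        (λ eq → ℕ.1+n≢n (≡-trans (cong suc (sym (length-map w As))) eq))
      tooFewRows : perₗ Fs (a ∷ As) ≡ + 0
      tooFewRows = perₗ-length Fs (a ∷ As) (λ eq → ℕ.1+n≢n (sym (≡-trans (sym (length-map w As)) eq)))

    bothDeleted : perₗ (fb⁰ ∷ fa⁰ ∷ Fs ++ Gs) (a ∷ As ++ b ∷ Bs) ≡ perInd w (a ∷ As) * perInd w (b ∷ Bs)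
    bothDeleted = begin
      perₗ (fb⁰ ∷ fa⁰ ∷ Fs ++ Gs) (a ∷ As ++ b ∷ Bs)
        ≡⟨ perₗ-↭ʳ (↭-sym (shift∷ fa⁰ fb⁰ Fs Gs)) _ ⟩
      perₗ ((fa⁰ ∷ Fs) ++ fb⁰ ∷ Gs) ((a ∷ As) ++ b ∷ Bs)
        ≡⟨ perₗ-block (fa⁰ ∷ Fs) (fb⁰ ∷ Gs) (a ∷ As) (b ∷ Bs) fa⁰Fs-vanish fb⁰Gs-vanish ⟩
      perₗ (fa⁰ ∷ Fs) (a ∷ As) * perₗ (fb⁰ ∷ Gs) (b ∷ Bs)
        ≡⟨ cong₂ _*_ (perₗ-cong-head Fs (a ∷ As) (λ c∈ → zeroAt-other (w a) (b∉ (∈-++⁺ˡ c∈))))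
                     (perₗ-cong-head Gs (b ∷ Bs) (λ c∈ → zeroAt-other (w b) (a∉ (∈-++⁺ʳ As c∈)))) ⟩
      perₗ (w a ∷ Fs) (a ∷ As) * perₗ (w b ∷ Gs) (b ∷ Bs)
        ≡⟨ cong₂ _*_ (perInd≡perₗ w (a ∷ As)) (perInd≡perₗ w (b ∷ Bs)) ⟨
      perInd w (a ∷ As) * perInd w (b ∷ Bs) ∎
      where open ≡-Reasoning

    withoutEdge : perₗ (fa⁰ ∷ Fs ++ w b ∷ Gs) (a ∷ As ++ b ∷ Bs) ≡ perInd w (a ∷ As) * perInd w (b ∷ Bs)
    withoutEdge = begin
      perₗ (fa⁰ ∷ Fs ++ w b ∷ Gs) (a ∷ As ++ b ∷ Bs)
        ≡⟨ perₗ-↭ʳ (shift∷ fa⁰ (w b) Fs Gs) _ ⟩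
      perₗ (w b ∷ fa⁰ ∷ Fs ++ Gs) (a ∷ As ++ b ∷ Bs)
        ≡⟨ perₗ-deleteEntry (w b) (fa⁰ ∷ Fs ++ Gs) a (As ++ b ∷ Bs) refl a∉ ⟩
      perₗ (fb⁰ ∷ fa⁰ ∷ Fs ++ Gs) (a ∷ As ++ b ∷ Bs) + w b a * perₗ (fa⁰ ∷ Fs ++ Gs) (As ++ b ∷ Bs)
        ≡⟨ cong (λ z → perₗ (fb⁰ ∷ fa⁰ ∷ Fs ++ Gs) (a ∷ As ++ b ∷ Bs) + w b a * z)
             (perₗ-block (fa⁰ ∷ Fs) Gs As (b ∷ Bs) fa⁰Fs-vanish (λ g∈ c∈ → Gs-vanish g∈ (there c∈))) ⟩
      perₗ (fb⁰ ∷ fa⁰ ∷ Fs ++ Gs) (a ∷ As ++ b ∷ Bs) + w b a * (perₗ (fa⁰ ∷ Fs) As * perₗ Gs (b ∷ Bs))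
        ≡⟨ cong₂ (λ x z → x + w b a * (z * perₗ Gs (b ∷ Bs))) bothDeleted tooManyRows ⟩
      perInd w (a ∷ As) * perInd w (b ∷ Bs) + w b a * (+ 0 * perₗ Gs (b ∷ Bs))
        ≡⟨ vanishing (perInd w (a ∷ As) * perInd w (b ∷ Bs)) (w b a) (perₗ Gs (b ∷ Bs)) ⟩
      perInd w (a ∷ As) * perInd w (b ∷ Bs) ∎
      where
      open ≡-Reasoning
      vanishing : ∀ p e q → p + e * (+ 0 * q) ≡ p
      vanishing = solve-∀

    throughEdge : perₗ (Fs ++ w b ∷ Gs) (a ∷ As ++ Bs) ≡ w b a * (perInd w As * perInd w Bs)
    throughEdge = begin
      perₗ (Fs ++ w b ∷ Gs) (a ∷ As ++ Bs)
        ≡⟨ perₗ-↭ʳ (shift (w b) Fs Gs) _ ⟩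
      perₗ (w b ∷ Fs ++ Gs) (a ∷ As ++ Bs)
        ≡⟨ perₗ-deleteEntry (w b) (Fs ++ Gs) a (As ++ Bs) refl a∉′ ⟩
      perₗ (fb⁰ ∷ Fs ++ Gs) (a ∷ As ++ Bs) + w b a * perₗ (Fs ++ Gs) (As ++ Bs)
        ≡⟨ cong₂ (λ x y → x + w b a * y)
             (≡-trans (perₗ-↭ʳ (↭-sym (shift fb⁰ Fs Gs)) _)
                      (perₗ-block Fs (fb⁰ ∷ Gs) (a ∷ As) Bs (λ f∈ c∈ → Fs-vanish f∈ (there c∈)) fb⁰Gs-vanish))
             (perₗ-block Fs Gs As Bs (λ f∈ c∈ → Fs-vanish f∈ (there c∈)) (λ g∈ c∈ → Gs-vanish g∈ (there c∈))) ⟩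
      perₗ Fs (a ∷ As) * perₗ (fb⁰ ∷ Gs) Bs + w b a * (perₗ Fs As * perₗ Gs Bs)
        ≡⟨ cong₂ (λ z y → z * perₗ (fb⁰ ∷ Gs) Bs + w b a * y) tooFewRows
             (sym (cong₂ _*_ (perInd≡perₗ w As) (perInd≡perₗ w Bs))) ⟩
      + 0 * perₗ (fb⁰ ∷ Gs) Bs + w b a * (perInd w As * perInd w Bs)
        ≡⟨ cong (_+ w b a * (perInd w As * perInd w Bs)) (*-zeroˡ (perₗ (fb⁰ ∷ Gs) Bs)) ⟩
      + 0 + w b a * (perInd w As * perInd w Bs)
        ≡⟨ +-identityˡ _ ⟩
      w b a * (perInd w As * perInd w Bs) ∎
      where open ≡-Reasoning

    expansion : perInd w (a ∷ As ++ b ∷ Bs) ≡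
                perInd w (a ∷ As) * perInd w (b ∷ Bs) + w a b * w b a * perInd w As * perInd w Bs
    expansion = begin
      perInd w (a ∷ As ++ b ∷ Bs)
        ≡⟨ perInd≡perₗ w (a ∷ As ++ b ∷ Bs) ⟩
      perₗ (w a ∷ map w (As ++ b ∷ Bs)) (a ∷ As ++ b ∷ Bs)
        ≡⟨ cong (λ rows → perₗ (w a ∷ rows) (a ∷ As ++ b ∷ Bs)) (map-++ w As (b ∷ Bs)) ⟩
      perₗ (w a ∷ Fs ++ w b ∷ Gs) (a ∷ As ++ b ∷ Bs)
        ≡⟨ perₗ-deleteEntry (w a) (Fs ++ w b ∷ Gs) b (a ∷ As ++ Bs) (shift∷ a b As Bs) b∉ ⟩
      perₗ (fa⁰ ∷ Fs ++ w b ∷ Gs) (a ∷ As ++ b ∷ Bs) + w a b * perₗ (Fs ++ w b ∷ Gs) (a ∷ As ++ Bs)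
        ≡⟨ cong₂ (λ x y → x + w a b * y) withoutEdge throughEdge ⟩
      perInd w (a ∷ As) * perInd w (b ∷ Bs) + w a b * (w b a * (perInd w As * perInd w Bs))
        ≡⟨ cong (λ z → perInd w (a ∷ As) * perInd w (b ∷ Bs) + z) (assoc (w a b) (w b a) (perInd w As) (perInd w Bs)) ⟩
      perInd w (a ∷ As) * perInd w (b ∷ Bs) + w a b * w b a * perInd w As * perInd w Bs ∎
      where
      open ≡-Reasoning
      assoc : ∀ e e′ p q → e * (e′ * (p * q)) ≡ e * e′ * p * q
      assoc = solve-∀

  perInd-cutEdge : ∀ (w : V → V → ℤ) a b As Bs → Unique (a ∷ As ++ b ∷ Bs) →
                   NoEdges w As (b ∷ Bs) → NoEdges w (a ∷ []) Bs →
                   perInd w (a ∷ As ++ b ∷ Bs) ≡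
                   perInd w (a ∷ As) * perInd w (b ∷ Bs) + w a b * w b a * perInd w As * perInd w Bs
  perInd-cutEdge w a b As Bs = CutEdge.expansion w

  perInd-leaf : ∀ (w : V → V → ℤ) a b As → Unique (a ∷ As ++ b ∷ []) → NoEdges w As (b ∷ []) → w b b ≡ + 0 →
                perInd w (a ∷ As ++ b ∷ []) ≡ w a b * w b a * perInd w As
  perInd-leaf w a b As uniq sep wbb≡0 = begin
    perInd w (a ∷ As ++ b ∷ [])
      ≡⟨ perInd-cutEdge w a b As [] uniq sep (λ _ ()) ⟩
    perInd w (a ∷ As) * (w b b * + 1 + + 0) + w a b * w b a * perInd w As * + 1
      ≡⟨ cong (λ z → perInd w (a ∷ As) * (z * + 1 + + 0) + w a b * w b a * perInd w As * + 1) wbb≡0 ⟩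
    perInd w (a ∷ As) * (+ 0 * + 1 + + 0) + w a b * w b a * perInd w As * + 1
      ≡⟨ simplify (perInd w (a ∷ As)) (w a b * w b a * perInd w As) ⟩
    w a b * w b a * perInd w As ∎
    where
    open ≡-Reasoning
    simplify : ∀ p q → p * (+ 0 * + 1 + + 0) + q * + 1 ≡ q
    simplify = solve-∀

-- The graph U

module _ {n m₁ m₂ : ℕ} where

  _≟ᵛ_ : DecidableEquality (UV n m₁ m₂)
  _≟ᵛ_ = ≡-dec _≟ᶠ_ (≡-dec _≟ᶠ_ _≟ᶠ_)

  unique-vertices : Unique (cycV n m₁ m₂ ++ tree₁V n m₁ m₂ ++ tree₂V n m₁ m₂)
  unique-vertices = Uniqueₚ.++⁺
    (Uniqueₚ.map⁺ inj₁-injective (Uniqueₚ.allFin⁺ n))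
    (Uniqueₚ.++⁺ (Uniqueₚ.map⁺ (inj₁-injective ∘ inj₂-injective) (Uniqueₚ.allFin⁺ m₁))
                (Uniqueₚ.map⁺ (inj₂-injective ∘ inj₂-injective) (Uniqueₚ.allFin⁺ m₂))
                (λ (v∈T₁ , v∈T₂) → tree₁∩tree₂ v∈T₁ v∈T₂))
    (λ (v∈C , v∈T) → cycle∩trees v∈C v∈T)
    where
    tree₁∩tree₂ : ∀ {v} → v ∈ tree₁V n m₁ m₂ → v ∈ tree₂V n m₁ m₂ → ⊥
    tree₁∩tree₂ v∈T₁ v∈T₂ with ∈-map⁻ _ v∈T₁ | ∈-map⁻ _ v∈T₂
    ... | _ , _ , ≡-refl | _ , _ , ()
    cycle∩trees : ∀ {v} → v ∈ cycV n m₁ m₂ → v ∈ tree₁V n m₁ m₂ ++ tree₂V n m₁ m₂ → ⊥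
    cycle∩trees v∈C v∈T with ∈-map⁻ inj₁ v∈C | ∈-++⁻ (tree₁V n m₁ m₂) v∈T
    ... | _ , _ , ≡-refl | inj₁ v∈T₁ with ∈-map⁻ _ v∈T₁
    ...   | _ , _ , ()
    cycle∩trees v∈C v∈T | _ , _ , ≡-refl | inj₂ v∈T₂ with ∈-map⁻ _ v∈T₂
    ...   | _ , _ , ()

joinW-self : ∀ {n m} (v : Fin n) (r : Fin m) e → joinW v r e v r ≡ e
joinW-self v r e with v ≟ᶠ v | r ≟ᶠ r
... | yes _ | yes _   = ≡-refl
... | no v≢v | _      = ⊥-elim (v≢v ≡-refl)
... | yes _ | no r≢r  = ⊥-elim (r≢r ≡-refl)

joinW-off : ∀ {n m} (v : Fin n) (r : Fin m) e {i a} → i ≢ v ⊎ a ≢ r → joinW v r e i a ≡ + 0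
joinW-off v r e {i} {a} off with i ≟ᶠ v | a ≟ᶠ r
... | yes i≡v | yes a≡r = ⊥-elim ([ (λ i≢v → i≢v i≡v) , (λ a≢r → a≢r a≡r) ] off)
... | yes _   | no _    = ≡-refl
... | no _    | _       = ≡-refl

cycAdj-away-from-0 : ∀ {n} {i j : Fin n} → CycAdj n i j → toℕ i ≢ 0 → toℕ j ≢ 0 →
                     toℕ j ≡ suc (toℕ i) ⊎ toℕ i ≡ suc (toℕ j)
cycAdj-away-from-0 (inj₁ j≡1+i)                     _   _   = inj₁ j≡1+i
cycAdj-away-from-0 (inj₂ (inj₁ i≡1+j))              _   _   = inj₂ i≡1+j
cycAdj-away-from-0 (inj₂ (inj₂ (inj₁ (i≡0 , _))))   i≢0 _   = ⊥-elim (i≢0 i≡0)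
cycAdj-away-from-0 (inj₂ (inj₂ (inj₂ (j≡0 , _))))   _   j≢0 = ⊥-elim (j≢0 j≡0)

module PendantTrees {n m₁ m₂ l : ℕ} (C : Fin n → Fin n → ℤ)
  (T₁ : Fin m₁ → Fin m₁ → ℤ) (r₁ : Fin m₁) (e₁ : ℤ)
  (T₂ : Fin m₂ → Fin m₂ → ℤ) (r₂ : Fin m₂) (e₂ : ℤ)
  (v₁ vₗ : Fin n) (v₁≡0 : toℕ v₁ ≡ 0) (vₗ≡l : toℕ vₗ ≡ l) (1≤l : 1 ≤ l)
  (isCycle : IsSignedCycle n C) where

  U : UV n m₁ m₂ → UV n m₁ m₂ → ℤ
  U = Uw C T₁ r₁ e₁ T₂ r₂ e₂ v₁ vₗ

  root₁ root₂ : UV n m₁ m₂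
  root₁ = inj₂ (inj₁ r₁)
  root₂ = inj₂ (inj₂ r₂)

  cycle tree₁ tree₂ path path₁ path₂ tree₁⁻ tree₂⁻ : List (UV n m₁ m₂)
  cycle = cycV n m₁ m₂
  tree₁  = tree₁V n m₁ m₂
  tree₂  = tree₂V n m₁ m₂
  path   = pathAllV n m₁ m₂
  path₁  = path₁V n m₁ m₂ l
  path₂  = path₂V n m₁ m₂ l
  tree₁⁻ = map (inj₂ ∘ inj₁) (filter (λ a → ¬? (r₁ ≟ᶠ a)) (allFin m₁))
  tree₂⁻ = map (inj₂ ∘ inj₂) (filter (λ a → ¬? (r₂ ≟ᶠ a)) (allFin m₂))

  ∈-tree₁⁻ : ∀ {x} → x ∈ tree₁⁻ → ∃ λ a → x ≡ inj₂ (inj₁ a) × a ≢ r₁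
  ∈-tree₁⁻ x∈ with ∈-map⁻ (inj₂ ∘ inj₁) x∈
  ... | a , a∈ , x≡ = a , x≡ , λ a≡r₁ →
    proj₂ (∈-filter⁻ (λ a → ¬? (r₁ ≟ᶠ a)) {xs = allFin m₁} a∈) (sym a≡r₁)

  ∈-tree₂⁻ : ∀ {x} → x ∈ tree₂⁻ → ∃ λ a → x ≡ inj₂ (inj₂ a) × a ≢ r₂
  ∈-tree₂⁻ x∈ with ∈-map⁻ (inj₂ ∘ inj₂) x∈
  ... | a , a∈ , x≡ = a , x≡ , λ a≡r₂ →
    proj₂ (∈-filter⁻ (λ a → ¬? (r₂ ≟ᶠ a)) {xs = allFin m₂} a∈) (sym a≡r₂)

  ∈-path : ∀ {y} → y ∈ path → ∃ λ i → y ≡ inj₁ i × i ≢ v₁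
  ∈-path y∈ with ∈-map⁻ inj₁ y∈
  ... | i , i∈ , y≡ = i , y≡ , λ { ≡-refl →
    ℕ.<-irrefl (sym v₁≡0) (proj₂ (∈-filter⁻ (λ i → 1 ≤? toℕ i) {xs = allFin n} i∈)) }

  ∈-path₁ : ∀ {y} → y ∈ path₁ → ∃ λ i → y ≡ inj₁ i × 1 ≤ toℕ i × toℕ i < l
  ∈-path₁ y∈ with ∈-map⁻ inj₁ y∈
  ... | i , i∈ , y≡ = i , y≡ , proj₂ (∈-filter⁻ (λ i → (1 ≤? toℕ i) ×-dec (toℕ i <? l)) {xs = allFin n} i∈)

  ∈-path₂ : ∀ {y} → y ∈ path₂ → ∃ λ i → y ≡ inj₁ i × l < toℕ i
  ∈-path₂ y∈ with ∈-map⁻ inj₁ y∈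
  ... | i , i∈ , y≡ = i , y≡ , proj₂ (∈-filter⁻ (λ i → l <? toℕ i) {xs = allFin n} i∈)

  ∈-path₁₂ : ∀ {y} → y ∈ path₁ ++ path₂ → ∃ λ i → y ≡ inj₁ i × i ≢ vₗ
  ∈-path₁₂ y∈ with ∈-++⁻ path₁ y∈
  ... | inj₁ y∈₁ with ∈-path₁ y∈₁
  ...   | i , y≡ , _ , i<l = i , y≡ , λ { ≡-refl → ℕ.<-irrefl vₗ≡l i<l }
  ∈-path₁₂ y∈ | inj₂ y∈₂ with ∈-path₂ y∈₂
  ...   | i , y≡ , l<i = i , y≡ , λ { ≡-refl → ℕ.<-irrefl (sym vₗ≡l) l<i }

  ∈-tree₂ : ∀ {y} → y ∈ tree₂ → ∃ λ a → y ≡ inj₂ (inj₂ a)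
  ∈-tree₂ y∈ with ∈-map⁻ (inj₂ ∘ inj₂) y∈
  ... | a , _ , y≡ = a , y≡

  tree₁-far : ∀ {y} → y ∈ path ++ tree₂ → ∀ a → U (inj₂ (inj₁ a)) y ≡ + 0 × U y (inj₂ (inj₁ a)) ≡ + 0
  tree₁-far y∈ a with ∈-++⁻ path y∈
  ... | inj₁ y∈P with ∈-path y∈P
  ...   | i , ≡-refl , i≢v₁ = joinW-off v₁ r₁ e₁ (inj₁ i≢v₁) , joinW-off v₁ r₁ e₁ (inj₁ i≢v₁)
  tree₁-far y∈ a | inj₂ y∈T with ∈-tree₂ y∈T
  ...   | _ , ≡-refl = ≡-refl , ≡-refl

  tree₂-far : ∀ {y} → y ∈ path₁ ++ path₂ → ∀ a → U (inj₂ (inj₂ a)) y ≡ + 0 × U y (inj₂ (inj₂ a)) ≡ + 0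
  tree₂-far y∈ a with ∈-path₁₂ y∈
  ... | i , ≡-refl , i≢vₗ = joinW-off vₗ r₂ e₂ (inj₁ i≢vₗ) , joinW-off vₗ r₂ e₂ (inj₁ i≢vₗ)

  tree₁⁻-v₁ : ∀ {x} → x ∈ tree₁⁻ → U x (inj₁ v₁) ≡ + 0 × U (inj₁ v₁) x ≡ + 0
  tree₁⁻-v₁ x∈ with ∈-tree₁⁻ x∈
  ... | a , ≡-refl , a≢r₁ = joinW-off v₁ r₁ e₁ (inj₂ a≢r₁) , joinW-off v₁ r₁ e₁ (inj₂ a≢r₁)

  tree₂⁻-vₗ : ∀ {x} → x ∈ tree₂⁻ → U x (inj₁ vₗ) ≡ + 0 × U (inj₁ vₗ) x ≡ + 0
  tree₂⁻-vₗ x∈ with ∈-tree₂⁻ x∈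
  ... | a , ≡-refl , a≢r₂ = joinW-off vₗ r₂ e₂ (inj₂ a≢r₂) , joinW-off vₗ r₂ e₂ (inj₂ a≢r₂)

  tree₁⁻-rest : NoEdges U tree₁⁻ (inj₁ v₁ ∷ path ++ tree₂)
  tree₁⁻-rest x∈ (here ≡-refl) = tree₁⁻-v₁ x∈
  tree₁⁻-rest x∈ (there y∈) with ∈-tree₁⁻ x∈
  ... | a , ≡-refl , _ = tree₁-far y∈ a

  tree₂⁻-rest : NoEdges U tree₂⁻ (inj₁ vₗ ∷ path₁ ++ path₂)
  tree₂⁻-rest x∈ (here ≡-refl) = tree₂⁻-vₗ x∈
  tree₂⁻-rest x∈ (there y∈) with ∈-tree₂⁻ x∈
  ... | a , ≡-refl , _ = tree₂-far y∈ a

  root₁-rest : NoEdges U (root₁ ∷ []) (path ++ tree₂)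
  root₁-rest (here ≡-refl) y∈ = tree₁-far y∈ r₁

  root₂-rest : NoEdges U (root₂ ∷ []) (path₁ ++ path₂)
  root₂-rest (here ≡-refl) y∈ = tree₂-far y∈ r₂

  diagonal : ∀ i → C i i ≡ + 0
  diagonal = proj₁ (proj₂ (proj₁ (proj₂ isCycle)))

  nonadjacent : ∀ i j → ¬ CycAdj n i j → C i j ≡ + 0
  nonadjacent i j ¬adj with C i j ℤ.≟ + 0
  ... | yes Cij≡0 = Cij≡0
  ... | no  Cij≢0 = ⊥-elim (¬adj (proj₁ (proj₂ (proj₂ isCycle) i j) Cij≢0))

  path₁-path₂ : NoEdges U path₁ path₂
  path₁-path₂ x∈ y∈ with ∈-path₁ x∈ | ∈-path₂ y∈
  ... | i , ≡-refl , 1≤i , i<l | j , ≡-refl , l<j =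
    nonadjacent i j (λ adj → apart (cycAdj-away-from-0 adj i≢0 j≢0)) ,
    nonadjacent j i (λ adj → apart (Sum.swap (cycAdj-away-from-0 adj j≢0 i≢0)))
    where
    i≢0 : toℕ i ≢ 0
    i≢0 i≡0 = ℕ.<-irrefl (sym i≡0) 1≤i
    j≢0 : toℕ j ≢ 0
    j≢0 j≡0 = ℕ.<-irrefl (sym j≡0) (ℕ.≤-<-trans z≤n l<j)
    apart : toℕ j ≡ suc (toℕ i) ⊎ toℕ i ≡ suc (toℕ j) → ⊥
    apart (inj₁ j≡1+i) = ℕ.<-irrefl ≡-refl (ℕ.<-≤-trans (subst (l <_) j≡1+i l<j) i<l)
    apart (inj₂ i≡1+j) = ℕ.<-irrefl ≡-refl
      (ℕ.<-trans i<l (ℕ.<-trans l<j (subst (toℕ j <_) (sym i≡1+j) (ℕ.n<1+n (toℕ j)))))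

  tree₁-↭ : tree₁ ↭ root₁ ∷ tree₁⁻
  tree₁-↭ = map⁺ (inj₂ ∘ inj₁) (extract _≟ᶠ_ (Uniqueₚ.allFin⁺ m₁) (∈-allFin r₁))

  tree₂-↭ : tree₂ ↭ root₂ ∷ tree₂⁻
  tree₂-↭ = map⁺ (inj₂ ∘ inj₂) (extract _≟ᶠ_ (Uniqueₚ.allFin⁺ m₂) (∈-allFin r₂))

  cycle-↭ : cycle ↭ inj₁ v₁ ∷ path
  cycle-↭ = map⁺ inj₁ (trans (extract _≟ᶠ_ (Uniqueₚ.allFin⁺ n) (∈-allFin v₁))
    (prep v₁ (↭-reflexive (filter-≐ (λ i → ¬? (v₁ ≟ᶠ i)) (λ i → 1 ≤? toℕ i) (positive , distinct) (allFin n)))))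
    where
    positive : ∀ {i} → ¬ v₁ ≡ i → 1 ≤ toℕ i
    positive v₁≢i = ℕ.n≢0⇒n>0 (λ i≡0 → v₁≢i (toℕ-injective (≡-trans v₁≡0 (sym i≡0))))
    distinct : ∀ {i} → 1 ≤ toℕ i → ¬ v₁ ≡ i
    distinct 1≤i ≡-refl = ℕ.<-irrefl (sym v₁≡0) 1≤i

  private
    1≤? : Decidable (λ (i : Fin n) → 1 ≤ toℕ i)
    1≤? i = 1 ≤? toℕ i
    <l? : Decidable (λ (i : Fin n) → toℕ i < l)
    <l? i = toℕ i <? l
    ≢vₗ? : Decidable (λ (i : Fin n) → ¬ vₗ ≡ i)
    ≢vₗ? i = ¬? (vₗ ≟ᶠ i)
    pathIndices : List (Fin n)
    pathIndices = filter ≢vₗ? (filter 1≤? (allFin n))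

    pathIndices-filter : ∀ {P : Pred (Fin n) 0ℓ} (P? : Decidable P) →
                         filter P? pathIndices ≡ filter (P? ∩? (≢vₗ? ∩? 1≤?)) (allFin n)
    pathIndices-filter P? = ≡-trans (cong (filter P?) (filter-filter ≢vₗ? 1≤? (allFin n)))
                                    (filter-filter P? (≢vₗ? ∩? 1≤?) (allFin n))

  path₁-indices : filter <l? pathIndices ≡ filter (λ i → 1≤? i ×-dec <l? i) (allFin n)
  path₁-indices = ≡-trans (pathIndices-filter <l?) (filter-≐ _ (λ i → 1≤? i ×-dec <l? i)
    ((λ (i<l , _ , 1≤i) → 1≤i , i<l) , λ (1≤i , i<l) → i<l , ≢vₗ i<l , 1≤i) (allFin n))
    where
    ≢vₗ : ∀ {i} → toℕ i < l → ¬ vₗ ≡ i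
    ≢vₗ i<l ≡-refl = ℕ.<-irrefl vₗ≡l i<l

  path₂-indices : filter (¬? ∘ <l?) pathIndices ≡ filter (λ i → l <? toℕ i) (allFin n)
  path₂-indices = ≡-trans (pathIndices-filter (¬? ∘ <l?)) (filter-≐ _ (λ i → l <? toℕ i)
    ((λ (¬i<l , i≢vₗ , _) → ℕ.≤∧≢⇒< (ℕ.≮⇒≥ ¬i<l) (λ l≡i → i≢vₗ (toℕ-injective (≡-trans vₗ≡l l≡i))))
    , λ l<i → ℕ.<-asym l<i , ≢vₗ l<i , ℕ.≤-trans 1≤l (ℕ.<⇒≤ l<i)) (allFin n))
    where
    ≢vₗ : ∀ {i} → l < toℕ i → ¬ vₗ ≡ i
    ≢vₗ l<i ≡-refl = ℕ.<-irrefl (sym vₗ≡l) l<i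

  path-↭ : path ↭ inj₁ vₗ ∷ path₁ ++ path₂
  path-↭ = begin
    map inj₁ (filter 1≤? (allFin n))
      ↭⟨ map⁺ inj₁ (extract _≟ᶠ_ (Uniqueₚ.filter⁺ 1≤? (Uniqueₚ.allFin⁺ n)) (∈-filter⁺ 1≤? (∈-allFin vₗ) 1≤vₗ)) ⟩
    inj₁ vₗ ∷ map inj₁ pathIndices
      ↭⟨ prep (inj₁ vₗ) (map⁺ inj₁ (↭-partition <l? pathIndices)) ⟩
    inj₁ vₗ ∷ map inj₁ (filter <l? pathIndices ++ filter (¬? ∘ <l?) pathIndices)
      ≡⟨ cong (λ is → inj₁ vₗ ∷ map inj₁ is) (cong₂ _++_ path₁-indices path₂-indices) ⟩
    inj₁ vₗ ∷ map inj₁ (filter (λ i → 1≤? i ×-dec <l? i) (allFin n) ++ filter (λ i → l <? toℕ i) (allFin n))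
      ≡⟨ cong (inj₁ vₗ ∷_) (map-++ inj₁ (filter (λ i → 1≤? i ×-dec <l? i) (allFin n)) _) ⟩
    inj₁ vₗ ∷ path₁ ++ path₂ ∎
    where
    open PermutationReasoning
    1≤vₗ : 1 ≤ toℕ vₗ
    1≤vₗ = subst (1 ≤_) (sym vₗ≡l) 1≤l

  arrangement₁ : cycle ++ tree₁ ++ tree₂ ↭ root₁ ∷ tree₁⁻ ++ inj₁ v₁ ∷ path ++ tree₂
  arrangement₁ = trans (++⁺ cycle-↭ (++⁺ʳ tree₂ tree₁-↭)) (shifts (inj₁ v₁ ∷ path) (root₁ ∷ tree₁⁻))

  arrangement₂ : path ++ tree₂ ↭ root₂ ∷ tree₂⁻ ++ inj₁ vₗ ∷ path₁ ++ path₂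
  arrangement₂ = trans (++⁺ path-↭ tree₂-↭) (++-comm (inj₁ vₗ ∷ path₁ ++ path₂) (root₂ ∷ tree₂⁻))

  unique₁ : Unique (root₁ ∷ tree₁⁻ ++ inj₁ v₁ ∷ path ++ tree₂)
  unique₁ = unique-↭ arrangement₁ unique-vertices

  unique₂ : Unique (root₂ ∷ tree₂⁻ ++ inj₁ vₗ ∷ path₁ ++ path₂)
  unique₂ with unique-++ʳ (root₁ ∷ tree₁⁻) unique₁
  ... | _ ∷ u = unique-↭ arrangement₂ u

  leaf₁ : perInd U (tree₁ ++ inj₁ v₁ ∷ []) ≡ e₁ * e₁ * perInd U tree₁⁻
  leaf₁ = begin
    perInd U (tree₁ ++ inj₁ v₁ ∷ [])
      ≡⟨ perInd-↭ U (++⁺ʳ (inj₁ v₁ ∷ []) tree₁-↭) ⟩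
    perInd U (root₁ ∷ tree₁⁻ ++ inj₁ v₁ ∷ [])
      ≡⟨ perInd-leaf _≟ᵛ_ U root₁ (inj₁ v₁) tree₁⁻ (unique-truncate (root₁ ∷ tree₁⁻) (inj₁ v₁) (path ++ tree₂) unique₁)
           (λ { x∈ (here ≡-refl) → tree₁⁻-v₁ x∈ }) (diagonal v₁) ⟩
    U root₁ (inj₁ v₁) * U (inj₁ v₁) root₁ * perInd U tree₁⁻
      ≡⟨ cong (λ e → e * e * perInd U tree₁⁻) (joinW-self v₁ r₁ e₁) ⟩
    e₁ * e₁ * perInd U tree₁⁻ ∎
    where open ≡-Reasoning

  leaf₂ : perInd U (tree₂ ++ inj₁ vₗ ∷ []) ≡ e₂ * e₂ * perInd U tree₂⁻
  leaf₂ = begin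
    perInd U (tree₂ ++ inj₁ vₗ ∷ [])
      ≡⟨ perInd-↭ U (++⁺ʳ (inj₁ vₗ ∷ []) tree₂-↭) ⟩
    perInd U (root₂ ∷ tree₂⁻ ++ inj₁ vₗ ∷ [])
      ≡⟨ perInd-leaf _≟ᵛ_ U root₂ (inj₁ vₗ) tree₂⁻ (unique-truncate (root₂ ∷ tree₂⁻) (inj₁ vₗ) (path₁ ++ path₂) unique₂)
           (λ { x∈ (here ≡-refl) → tree₂⁻-vₗ x∈ }) (diagonal vₗ) ⟩
    U root₂ (inj₁ vₗ) * U (inj₁ vₗ) root₂ * perInd U tree₂⁻
      ≡⟨ cong (λ e → e * e * perInd U tree₂⁻) (joinW-self vₗ r₂ e₂) ⟩
    e₂ * e₂ * perInd U tree₂⁻ ∎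
    where open ≡-Reasoning

  expand₁ : perInd U (cycle ++ tree₁ ++ tree₂) ≡
            perInd U tree₁ * perInd U (cycle ++ tree₂) + e₁ * e₁ * perInd U tree₁⁻ * perInd U (path ++ tree₂)
  expand₁ = begin
    perInd U (cycle ++ tree₁ ++ tree₂)
      ≡⟨ perInd-↭ U arrangement₁ ⟩
    perInd U (root₁ ∷ tree₁⁻ ++ inj₁ v₁ ∷ path ++ tree₂)
      ≡⟨ perInd-cutEdge _≟ᵛ_ U root₁ (inj₁ v₁) tree₁⁻ (path ++ tree₂) unique₁ tree₁⁻-rest root₁-rest ⟩
    perInd U (root₁ ∷ tree₁⁻) * perInd U (inj₁ v₁ ∷ path ++ tree₂)
      + U root₁ (inj₁ v₁) * U (inj₁ v₁) root₁ * perInd U tree₁⁻ * perInd U (path ++ tree₂)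
      ≡⟨ cong₂ (λ x e → x + e * e * perInd U tree₁⁻ * perInd U (path ++ tree₂))
           (cong₂ _*_ (perInd-↭ U (↭-sym tree₁-↭)) (perInd-↭ U (↭-sym (++⁺ʳ tree₂ cycle-↭))))
           (joinW-self v₁ r₁ e₁) ⟩
    perInd U tree₁ * perInd U (cycle ++ tree₂) + e₁ * e₁ * perInd U tree₁⁻ * perInd U (path ++ tree₂) ∎
    where open ≡-Reasoning

  expand₂ : perInd U (path ++ tree₂) ≡
            perInd U tree₂ * perInd U path + e₂ * e₂ * perInd U tree₂⁻ * (perInd U path₁ * perInd U path₂)
  expand₂ = begin
    perInd U (path ++ tree₂)
      ≡⟨ perInd-↭ U arrangement₂ ⟩
    perInd U (root₂ ∷ tree₂⁻ ++ inj₁ vₗ ∷ path₁ ++ path₂)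
      ≡⟨ perInd-cutEdge _≟ᵛ_ U root₂ (inj₁ vₗ) tree₂⁻ (path₁ ++ path₂) unique₂ tree₂⁻-rest root₂-rest ⟩
    perInd U (root₂ ∷ tree₂⁻) * perInd U (inj₁ vₗ ∷ path₁ ++ path₂)
      + U root₂ (inj₁ vₗ) * U (inj₁ vₗ) root₂ * perInd U tree₂⁻ * perInd U (path₁ ++ path₂)
      ≡⟨ cong₂ (λ x e → x + e * e * perInd U tree₂⁻ * perInd U (path₁ ++ path₂))
           (cong₂ _*_ (perInd-↭ U (↭-sym tree₂-↭)) (perInd-↭ U (↭-sym path-↭)))
           (joinW-self vₗ r₂ e₂) ⟩
    perInd U tree₂ * perInd U path + e₂ * e₂ * perInd U tree₂⁻ * perInd U (path₁ ++ path₂)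
      ≡⟨ cong (λ z → perInd U tree₂ * perInd U path + e₂ * e₂ * perInd U tree₂⁻ * z)
           (perInd-++ U path₁ path₂ path₁-path₂) ⟩
    perInd U tree₂ * perInd U path + e₂ * e₂ * perInd U tree₂⁻ * (perInd U path₁ * perInd U path₂) ∎
    where open ≡-Reasoning

  perInd-U : perInd U (cycle ++ tree₁ ++ tree₂)
             ≡ perInd U (cycle ++ tree₂) * perInd U tree₁
               + perInd U (tree₁ ++ inj₁ v₁ ∷ []) * perInd U (tree₂ ++ inj₁ vₗ ∷ [])
                 * perInd U path₁ * perInd U path₂
               + perInd U (tree₁ ++ inj₁ v₁ ∷ []) * perInd U tree₂ * perInd U path
  perInd-U = begin
    perInd U (cycle ++ tree₁ ++ tree₂)
      ≡⟨ expand₁ ⟩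
    perT₁ * perCT₂ + e₁ * e₁ * perT₁⁻ * perInd U (path ++ tree₂)
      ≡⟨ cong (λ z → perT₁ * perCT₂ + e₁ * e₁ * perT₁⁻ * z) expand₂ ⟩
    perT₁ * perCT₂ + e₁ * e₁ * perT₁⁻ * (perT₂ * perP + e₂ * e₂ * perT₂⁻ * (perP₁ * perP₂))
      ≡⟨ rearrange perT₁ perCT₂ (e₁ * e₁ * perT₁⁻) (e₂ * e₂ * perT₂⁻) perT₂ perP perP₁ perP₂ ⟩
    perCT₂ * perT₁ + e₁ * e₁ * perT₁⁻ * (e₂ * e₂ * perT₂⁻) * perP₁ * perP₂ + e₁ * e₁ * perT₁⁻ * perT₂ * perP
      ≡⟨ cong₂ (λ x y → perCT₂ * perT₁ + x * y * perP₁ * perP₂ + x * perT₂ * perP) leaf₁ leaf₂ ⟨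
    perCT₂ * perT₁
      + perInd U (tree₁ ++ inj₁ v₁ ∷ []) * perInd U (tree₂ ++ inj₁ vₗ ∷ []) * perP₁ * perP₂
      + perInd U (tree₁ ++ inj₁ v₁ ∷ []) * perT₂ * perP ∎
    where
    open ≡-Reasoning
    perT₁ perT₂ perT₁⁻ perT₂⁻ perCT₂ perP perP₁ perP₂ : ℤ
    perT₁  = perInd U tree₁
    perT₂  = perInd U tree₂
    perT₁⁻ = perInd U tree₁⁻
    perT₂⁻ = perInd U tree₂⁻
    perCT₂ = perInd U (cycle ++ tree₂)
    perP   = perInd U path
    perP₁  = perInd U path₁
    perP₂  = perInd U path₂
    rearrange : ∀ t c a b t₂ p p₁ p₂ → t * c + a * (t₂ * p + b * (p₁ * p₂)) ≡ c * t + a * b * p₁ * p₂ + a * t₂ * p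
    rearrange = solve-∀

corollary4 : (n m₁ m₂ l : ℕ) (C : Fin n → Fin n → ℤ)
  (T₁ : Fin m₁ → Fin m₁ → ℤ) (r₁ : Fin m₁) (e₁ : ℤ)
  (T₂ : Fin m₂ → Fin m₂ → ℤ) (r₂ : Fin m₂) (e₂ : ℤ) →
  IsSignedCycle n C → IsSignedTree T₁ → IsSignedTree T₂ → IsSign e₁ → IsSign e₂ →
  1 ≤ l → (l<n : l < n) → l ≤ n ∸ l →
  let v₁ = fromℕ< {0} (≤-trans (s≤s z≤n) l<n)
      vₗ = fromℕ< l<n
      U  = Uw C T₁ r₁ e₁ T₂ r₂ e₂ v₁ vₗ
  in perInd U (cycV n m₁ m₂ ++ tree₁V n m₁ m₂ ++ tree₂V n m₁ m₂)
     ≡ perInd U (cycV n m₁ m₂ ++ tree₂V n m₁ m₂) * perInd U (tree₁V n m₁ m₂)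
       + perInd U (tree₁V n m₁ m₂ ++ inj₁ v₁ ∷ [])
         * perInd U (tree₂V n m₁ m₂ ++ inj₁ vₗ ∷ [])
         * perInd U (path₁V n m₁ m₂ l) * perInd U (path₂V n m₁ m₂ l)
       + perInd U (tree₁V n m₁ m₂ ++ inj₁ v₁ ∷ []) * perInd U (tree₂V n m₁ m₂)
         * perInd U (pathAllV n m₁ m₂)
corollary4 n m₁ m₂ l C T₁ r₁ e₁ T₂ r₂ e₂ isCycle _ _ _ _ 1≤l l<n _ =
  PendantTrees.perInd-U C T₁ r₁ e₁ T₂ r₂ e₂ v₁ vₗ (toℕ-fromℕ< 0<n) (toℕ-fromℕ< l<n) 1≤l isCycle
  where
  0<n : 0 < n
  0<n = ≤-trans (s≤s z≤n) l<n
  v₁ vₗ : Fin n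
  v₁ = fromℕ< 0<n
  vₗ = fromℕ< l<n
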